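{- Let $n>3$ and $k>1$ be integers, and let $kP_n$ denote the disjoint union of $k$ copies of the path $P_n$ on $n$ vertices. Then $dern(kP_n)=2$.
   Context: All graphs are finite, simple and undirected. For an edge $e=uv$, $d(e)=d(u)+d(v)-2$. A da-ecard of $G$ is a pair $(G-e,d(e))$ with $G-e$ the unlabelled edge-deleted subgraph; the da-edeck is the multiset of all da-ecards. $dern(G)$ is the minimum $k$ such that some multiset of $k$ da-ecards of $G$ is not contained in the da-edeck of any graph not isomorphic to $G$. -}

module Defs where

open import Data.Nat using (ℕ; zero; suc; _+_; _∸_; _<_; _≡ᵇ_)
open import Data.Bool using (Bool; true; false; _∧_; _∨_; not; if_then_else_)
open import Data.Fin as F using (Fin; toℕ; splitAt)
open import Data.Fin.Properties using () renaming (_≟_ to _≟F_)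
open import Data.List using (List; map; allFin)
open import Data.Nat.ListAction using (sum)
open import Data.Product using (Σ; _×_; _,_)
open import Data.Sum using (_⊎_; inj₁; inj₂)
open import Relation.Nullary using (¬_)
open import Relation.Nullary.Decidable using (⌊_⌋)
open import Relation.Binary.PropositionalEquality using (_≡_)
open import Function.Bundles using (_↔_; Inverse)
open import Function.Definitions using (Injective)

record Graph : Set where
  constructor mkGraph
  field
    n   : ℕ
    adj : Fin n → Fin n → Bool
open Graph public

IsSimple : Graph → Set
IsSimple G = (∀ i j → adj G i j ≡ adj G j i) × (∀ i → adj G i i ≡ false)

Iso : Graph → Graph → Set
Iso G H = Σ (Fin (n G) ↔ Fin (n H)) λ σ →
  ∀ i j → adj G i j ≡ adj H (Inverse.to σ i) (Inverse.to σ j)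

-- an edge uv, stored with u < v so each edge appears once
record Edge (G : Graph) : Set where
  constructor mkEdge
  field
    u v    : Fin (n G)
    u<v    : u F.< v
    isEdge : adj G u v ≡ true
open Edge public

ends : {G : Graph} → Edge G → Fin (n G) × Fin (n G)
ends e = u e , v e

deg : (G : Graph) → Fin (n G) → ℕ
deg G i = sum (map (λ j → if adj G i j then 1 else 0) (allFin (n G)))

edeg : (G : Graph) → Edge G → ℕ
edeg G e = deg G (u e) + deg G (v e) ∸ 2

deleteEdge : (G : Graph) → Edge G → Graph
deleteEdge G e = mkGraph (n G) λ i j →
  adj G i j ∧ not ((⌊ i ≟F u e ⌋ ∧ ⌊ j ≟F v e ⌋) ∨ (⌊ i ≟F v e ⌋ ∧ ⌊ j ≟F u e ⌋))

-- A multiset of k da-ecards of G: the cards of k distinct edges of G.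
DistinctEdges : (G : Graph) (k : ℕ) → (Fin k → Edge G) → Set
DistinctEdges G k f = Injective _≡_ _≡_ (λ i → ends (f i))

-- The multiset of da-ecards {(G - f i, d(f i))} is contained in the da-edeck of H:
-- there are k distinct edges of H whose da-ecards match them one by one.
ContainedIn : (G : Graph) (k : ℕ) → (Fin k → Edge G) → Graph → Set
ContainedIn G k f H = Σ (Fin k → Edge H) λ g → DistinctEdges H k g ×
  (∀ i → Iso (deleteEdge H (g i)) (deleteEdge G (f i)) × (edeg H (g i) ≡ edeg G (f i)))

Determines : (G : Graph) (k : ℕ) → (Fin k → Edge G) → Set
Determines G k f = ∀ (H : Graph) → IsSimple H → ¬ Iso H G → ¬ ContainedIn G k f H

DernIs : Graph → ℕ → Set
DernIs G k =
  (Σ (Fin k → Edge G) λ f → DistinctEdges G k f × Determines G k f) ×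
  (∀ j → j < k → ∀ (f : Fin j → Edge G) → DistinctEdges G j f → ¬ Determines G j f)

path : ℕ → Graph
path m = mkGraph m λ i j → (suc (toℕ i) ≡ᵇ toℕ j) ∨ (suc (toℕ j) ≡ᵇ toℕ i)

-- disjoint union (vertices of G first, then those of H)
private
  sumAdj : (G H : Graph) → Fin (n G) ⊎ Fin (n H) → Fin (n G) ⊎ Fin (n H) → Bool
  sumAdj G H (inj₁ a) (inj₁ b) = adj G a b
  sumAdj G H (inj₂ a) (inj₂ b) = adj H a b
  sumAdj G H (inj₁ _) (inj₂ _) = false
  sumAdj G H (inj₂ _) (inj₁ _) = false

_⊕_ : Graph → Graph → Graph
G ⊕ H = mkGraph (n G + n H) λ x y → sumAdj G H (splitAt (n G) x) (splitAt (n G) y)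

copies : ℕ → Graph → Graph
copies zero G = mkGraph 0 λ _ _ → false
copies (suc k) G = G ⊕ copies k G

module Submission where

-- dern(kP_L) = 2 for L > 3 and k > 1.  The vertices of G = kP_L are the
-- numbers 0 … kL-1, and x ~ x+1 is an edge unless L divides x+1.  The key
-- fact is that G has no path on L+1 vertices (`noLongPath`).
--
-- Lower bound: the empty multiset lies in the deck of the empty graph, and a
-- card (G - XY, d(XY)) is also a card of H = G - XY + Az, where A ∈ {X,Y} has
-- its partner of degree 2 and z starts a block missing X, Y; H has a path on
-- L+1 vertices, so H ≇ G (`MovedEdge`).
-- Upper bound: if H has the cards of {0,1} and {1,2}, the first one gives
-- H ≅ G - {0,1} + {0,w} with w an end of a path of G - {0,1}.  For w = 1 and
-- w = L-1, H ≅ G; for w ≥ L the second card is impossible, since G - {1,2}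
-- has neither a path on L+1 vertices nor a component P_{L-1}
-- (`FarReattachment`, `noIsolatedPath`).

open import Defs
open import Data.Nat
open import Data.Nat.Properties
open import Data.Nat.DivMod
open import Data.Bool using (Bool; true; false; _∧_; _∨_; not; if_then_else_; T)
open import Data.Bool.Properties using (∨-comm; ∧-identityʳ; ∧-zeroʳ; ∨-identityʳ)
open import Data.Fin as F using (Fin; toℕ; fromℕ<; splitAt)
open import Data.Fin.Properties
  using (toℕ-fromℕ<; toℕ-injective; toℕ<n; splitAt⁻¹-↑ˡ; splitAt⁻¹-↑ʳ; toℕ-↑ˡ; toℕ-↑ʳ)
  renaming (_≟_ to _≟F_)
open import Data.List using (tabulate)
open import Data.List.Properties using (map-tabulate)
open import Data.Nat.ListAction using (sum)
open import Data.Sum using (_⊎_; inj₁; inj₂; [_,_])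
open import Data.Product using (Σ; _×_; _,_; proj₁; proj₂)
open import Data.Empty using (⊥; ⊥-elim)
open import Relation.Nullary using (¬_; yes; no; Dec)
open import Relation.Nullary.Decidable using (⌊_⌋)
open import Relation.Binary.PropositionalEquality hiding ([_])
open import Function.Bundles using (_↔_; Inverse; mk↔ₛ′)
open import Function.Construct.Identity using (↔-id)
open import Function.Construct.Composition using (_↔-∘_)
open import Function.Construct.Symmetry using (↔-sym)
open import Algebra.Properties.CommutativeMonoid.Sum +-0-commutativeMonoid
  using (sum-cong-≗; sum-permute; ∑-distrib-+) renaming (sum to total)

t≢f : ¬ true ≡ false
t≢f ()

∧-l : ∀ {a b} → a ∧ b ≡ true → a ≡ true
∧-l {true} _ = refl

∧-r : ∀ {a b} → a ∧ b ≡ true → b ≡ true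
∧-r {true} e = e

∨-e : ∀ {a b} → a ∨ b ≡ true → a ≡ true ⊎ b ≡ true
∨-e {true} _ = inj₁ refl
∨-e {false} e = inj₂ e

∨-l : ∀ {a b} → a ≡ true → a ∨ b ≡ true
∨-l refl = refl

∨-r : ∀ {a b} → b ≡ true → a ∨ b ≡ true
∨-r {true} _ = refl
∨-r {false} e = e

and-not : ∀ {a} b → a ≡ true → b ≡ false → a ∧ not b ≡ true
and-not b refl refl = refl

not-true : ∀ {a} → not a ≡ true → a ≡ false
not-true {false} _ = refl

not-true⇒false : ∀ {a} → ¬ a ≡ true → a ≡ false
not-true⇒false {true} h = ⊥-elim (h refl)
not-true⇒false {false} _ = refl

true≢false : ∀ {a} → a ≡ true → a ≡ false → ⊥
true≢false refl ()

bool-ext : ∀ {a b} → (a ≡ true → b ≡ true) → (b ≡ true → a ≡ true) → a ≡ b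
bool-ext {false} {false} _ _ = refl
bool-ext {false} {true} _ g = g refl
bool-ext {true} {false} f _ = sym (f refl)
bool-ext {true} {true} _ _ = refl

absorb : ∀ b c → (c ≡ true → b ≡ true) → (b ∧ not c) ∨ c ≡ b
absorb true true _ = refl
absorb false true h = sym (h refl)
absorb true false _ = refl
absorb false false _ = refl

drop-added : ∀ b c → (c ≡ true → b ≡ false) → (b ∨ c) ∧ not c ≡ b
drop-added b false _ = trans (cong (_∧ true) (∨-identityʳ b)) (∧-identityʳ b)
drop-added true true h = sym (h refl)
drop-added false true _ = refl

≡ᵇ-true : ∀ {x y} → (x ≡ᵇ y) ≡ true → x ≡ y
≡ᵇ-true {x} {y} e = ≡ᵇ⇒≡ x y (subst T (sym e) _)

≡ᵇ-refl : ∀ x → (x ≡ᵇ x) ≡ true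
≡ᵇ-refl zero = refl
≡ᵇ-refl (suc x) = ≡ᵇ-refl x

≡ᵇ-false : ∀ {x y} → ¬ x ≡ y → (x ≡ᵇ y) ≡ false
≡ᵇ-false ne = not-true⇒false λ e → ne (≡ᵇ-true e)

≡ᵇ-sym : ∀ x y → (x ≡ᵇ y) ≡ (y ≡ᵇ x)
≡ᵇ-sym x y = bool-ext (λ e → subst (λ z → (y ≡ᵇ z) ≡ true) (sym (≡ᵇ-true e)) (≡ᵇ-refl y))
                      (λ e → subst (λ z → (x ≡ᵇ z) ≡ true) (sym (≡ᵇ-true e)) (≡ᵇ-refl x))

≡ᵇ-+ : ∀ c x y → (c + x ≡ᵇ c + y) ≡ (x ≡ᵇ y)
≡ᵇ-+ zero x y = refl
≡ᵇ-+ (suc c) x y = ≡ᵇ-+ c x y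

suc-≡ᵇ : ∀ b c → ¬ c ≡ 0 → (suc b ≡ᵇ c) ≡ (b ≡ᵇ pred c)
suc-≡ᵇ b zero ne = ⊥-elim (ne refl)
suc-≡ᵇ b (suc c) _ = refl

≟F-toℕ : ∀ {M} (i j : Fin M) → ⌊ i ≟F j ⌋ ≡ (toℕ i ≡ᵇ toℕ j)
≟F-toℕ i j with i ≟F j
... | yes refl = sym (≡ᵇ-refl (toℕ i))
... | no ne = sym (≡ᵇ-false (λ e → ne (toℕ-injective e)))

isPair : ℕ → ℕ → ℕ → ℕ → Bool
isPair x y a b = ((a ≡ᵇ x) ∧ (b ≡ᵇ y)) ∨ ((a ≡ᵇ y) ∧ (b ≡ᵇ x))

isPair-true : ∀ {x y a b} → isPair x y a b ≡ true → (a ≡ x × b ≡ y) ⊎ (a ≡ y × b ≡ x)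
isPair-true {x} {y} {a} {b} e with ∨-e {(a ≡ᵇ x) ∧ (b ≡ᵇ y)} e
... | inj₁ p = inj₁ (≡ᵇ-true (∧-l p) , ≡ᵇ-true (∧-r {a ≡ᵇ x} p))
... | inj₂ p = inj₂ (≡ᵇ-true (∧-l p) , ≡ᵇ-true (∧-r {a ≡ᵇ y} p))

isPair-xy : ∀ x y → isPair x y x y ≡ true
isPair-xy x y rewrite ≡ᵇ-refl x | ≡ᵇ-refl y = refl

isPair-yx : ∀ x y → isPair x y y x ≡ true
isPair-yx x y rewrite ≡ᵇ-refl x | ≡ᵇ-refl y = ∨-r {(y ≡ᵇ x) ∧ (x ≡ᵇ y)} refl

isPair-false : ∀ {x y a b} → ¬ (a ≡ x × b ≡ y) → ¬ (a ≡ y × b ≡ x) → isPair x y a b ≡ false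
isPair-false h₁ h₂ = not-true⇒false λ e → [ h₁ , h₂ ] (isPair-true e)

isPair-false⁻ : ∀ {x y a b} → isPair x y a b ≡ false → ¬ (a ≡ x × b ≡ y) × ¬ (a ≡ y × b ≡ x)
isPair-false⁻ {x} {y} e =
  (λ { (refl , refl) → true≢false (isPair-xy x y) e }) , (λ { (refl , refl) → true≢false (isPair-yx x y) e })

isPair-swap : ∀ x y a b → isPair x y a b ≡ isPair y x a b
isPair-swap x y a b = bool-ext (swap {x} {y}) (swap {y} {x})
  where
  swap : ∀ {x y} → isPair x y a b ≡ true → isPair y x a b ≡ true
  swap {x} {y} e with isPair-true {x} {y} {a} {b} e
  ... | inj₁ (refl , refl) = isPair-yx y x
  ... | inj₂ (refl , refl) = isPair-xy y x

isPair-flip : ∀ x y a b → isPair x y a b ≡ isPair x y b a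
isPair-flip x y a b = bool-ext (flip {a} {b}) (flip {b} {a})
  where
  flip : ∀ {a b} → isPair x y a b ≡ true → isPair x y b a ≡ true
  flip {a} {b} e with isPair-true {x} {y} {a} {b} e
  ... | inj₁ (refl , refl) = isPair-yx x y
  ... | inj₂ (refl , refl) = isPair-xy x y

isPair-at₁ : ∀ {x y} → ¬ x ≡ y → ∀ b → isPair x y x b ≡ (b ≡ᵇ y)
isPair-at₁ {x} {y} ne b rewrite ≡ᵇ-refl x | ≡ᵇ-false ne = ∨-identityʳ (b ≡ᵇ y)

isPair-at₂ : ∀ {x y} → ¬ x ≡ y → ∀ b → isPair x y y b ≡ (b ≡ᵇ x)
isPair-at₂ {x} {y} ne b rewrite ≡ᵇ-refl y | ≡ᵇ-false (λ e → ne (sym e)) = refl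

ind : Bool → ℕ
ind b = if b then 1 else 0

count : ∀ {N} → (Fin N → Bool) → ℕ
count f = total (λ j → ind (f j))

deg≡count : ∀ G i → deg G i ≡ count (adj G i)
deg≡count G i = trans (cong sum (map-tabulate (λ j → j) (λ j → ind (adj G i j))))
                      (sum-tabulate (λ j → ind (adj G i j)))
  where
  sum-tabulate : ∀ {N} (g : Fin N → ℕ) → sum (tabulate g) ≡ total g
  sum-tabulate {zero} g = refl
  sum-tabulate {suc N} g = cong (g F.zero +_) (sum-tabulate (λ j → g (F.suc j)))

count-cong : ∀ {N} {f g : Fin N → Bool} → (∀ j → f j ≡ g j) → count f ≡ count g
count-cong e = sum-cong-≗ (λ j → cong ind (e j))

count-permute : ∀ {A B} (σ : Fin A ↔ Fin B) (f : Fin B → Bool) →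
                count f ≡ count (λ j → f (Inverse.to σ j))
count-permute σ f = sum-permute (λ j → ind (f j)) σ

count-mono : ∀ {N} {f g : Fin N → Bool} → (∀ j → f j ≡ true → g j ≡ true) → count f ≤ count g
count-mono {zero} _ = z≤n
count-mono {suc N} h = +-mono-≤ (ind-mono (h F.zero)) (count-mono (λ j → h (F.suc j)))
  where
  ind-mono : ∀ {a b} → (a ≡ true → b ≡ true) → ind a ≤ ind b
  ind-mono {false} _ = z≤n
  ind-mono {true} h rewrite h refl = ≤-refl

count-∨ : ∀ {N} (f g : Fin N → Bool) → (∀ j → f j ≡ true → g j ≡ true → ⊥) →
          count (λ j → f j ∨ g j) ≡ count f + count g
count-∨ f g disj = trans (sum-cong-≗ (λ j → ind-∨ (f j) (g j) (disj j)))
                         (∑-distrib-+ (λ j → ind (f j)) (λ j → ind (g j)))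
  where
  ind-∨ : ∀ a b → (a ≡ true → b ≡ true → ⊥) → ind (a ∨ b) ≡ ind a + ind b
  ind-∨ false b _ = refl
  ind-∨ true false _ = refl
  ind-∨ true true h = ⊥-elim (h refl refl)

δ : ∀ {N} → Fin N → Fin N → Bool
δ a j = ⌊ j ≟F a ⌋

δ-true : ∀ {N} {a j : Fin N} → δ a j ≡ true → j ≡ a
δ-true {a = a} {j} e with j ≟F a
... | yes p = p
... | no _ = ⊥-elim (t≢f (sym e))

count-δ : ∀ {N} (a : Fin N) → count (δ a) ≡ 1
count-δ {suc N} F.zero = cong suc (count-none {N})
  where
  count-none : ∀ {N} → count {N} (λ _ → false) ≡ 0
  count-none {zero} = refl
  count-none {suc N} = count-none {N}
count-δ {suc N} (F.suc a) =
  trans (count-cong {f = λ j → δ (F.suc a) (F.suc j)} {g = δ a} (δ-suc a)) (count-δ a)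
  where
  δ-suc : ∀ {N} (a j : Fin N) → δ (F.suc a) (F.suc j) ≡ δ a j
  δ-suc a j with j ≟F a
  ... | yes _ = refl
  ... | no _ = refl

count≥1 : ∀ {N} {f : Fin N → Bool} (a : Fin N) → f a ≡ true → 1 ≤ count f
count≥1 {f = f} a fa = subst (_≤ count f) (count-δ a)
  (count-mono {f = δ a} λ j e → subst (λ z → f z ≡ true) (sym (δ-true e)) fa)

count-δ₂ : ∀ {N} {a b : Fin N} → ¬ a ≡ b → count (λ j → δ a j ∨ δ b j) ≡ 2
count-δ₂ {a = a} {b} ne =
  trans (count-∨ (δ a) (δ b) λ j p q → ne (trans (sym (δ-true p)) (δ-true q)))
        (cong₂ _+_ (count-δ a) (count-δ b))

count≥2 : ∀ {N} {f : Fin N → Bool} (a b : Fin N) → ¬ a ≡ b → f a ≡ true → f b ≡ true → 2 ≤ count f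
count≥2 {f = f} a b ne fa fb = subst (_≤ count f) (count-δ₂ ne) (count-mono {f = λ j → δ a j ∨ δ b j} both)
  where
  both : ∀ j → δ a j ∨ δ b j ≡ true → f j ≡ true
  both j e with ∨-e {δ a j} e
  ... | inj₁ p = subst (λ z → f z ≡ true) (sym (δ-true p)) fa
  ... | inj₂ p = subst (λ z → f z ≡ true) (sym (δ-true p)) fb

deleteEdge-adj : ∀ (Γ : Graph) (e : Edge Γ) i j →
  adj (deleteEdge Γ e) i j ≡ adj Γ i j ∧ not (isPair (toℕ (u e)) (toℕ (v e)) (toℕ i) (toℕ j))
deleteEdge-adj Γ e i j rewrite ≟F-toℕ i (u e) | ≟F-toℕ j (v e) | ≟F-toℕ i (v e) | ≟F-toℕ j (u e) = refl

deleteEdge-deg : ∀ (Γ : Graph) (e : Edge Γ) p q → adj Γ p q ≡ true →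
  isPair (toℕ (u e)) (toℕ (v e)) (toℕ p) (toℕ q) ≡ true → deg (deleteEdge Γ e) p + 1 ≤ deg Γ p
deleteEdge-deg Γ e p q pq-edge pq-deleted =
  subst₂ _≤_ (trans (count-∨ (adj Γ-e p) (δ q) disjoint) (cong₂ _+_ (sym (deg≡count Γ-e p)) (count-δ q)))
             (sym (deg≡count Γ p))
             (count-mono {f = λ r → adj Γ-e p r ∨ δ q r} {g = adj Γ p} mono)
  where
  Γ-e = deleteEdge Γ e
  disjoint : ∀ r → adj Γ-e p r ≡ true → δ q r ≡ true → ⊥
  disjoint r a d rewrite δ-true d | deleteEdge-adj Γ e p q | pq-deleted = true≢false a (∧-zeroʳ (adj Γ p q))
  mono : ∀ r → adj Γ-e p r ∨ δ q r ≡ true → adj Γ p r ≡ true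
  mono r x with ∨-e {adj Γ-e p r} x
  ... | inj₁ a = ∧-l (trans (sym (deleteEdge-adj Γ e p r)) a)
  ... | inj₂ d rewrite δ-true d = pq-edge

to-injective : ∀ {A B : Set} (σ : A ↔ B) {x y} → Inverse.to σ x ≡ Inverse.to σ y → x ≡ y
to-injective σ {x} {y} e =
  trans (sym (Inverse.inverseʳ σ refl)) (trans (cong (Inverse.from σ) e) (Inverse.inverseʳ σ refl))

≡ᵇ-injective : ∀ {A B} (φ : Fin A → Fin B) → (∀ {x y} → φ x ≡ φ y → x ≡ y) → ∀ a b →
               (toℕ a ≡ᵇ toℕ b) ≡ (toℕ (φ a) ≡ᵇ toℕ (φ b))
≡ᵇ-injective φ inj a b = bool-ext
  (λ e → subst (λ z → (toℕ (φ a) ≡ᵇ toℕ (φ z)) ≡ true) (toℕ-injective (≡ᵇ-true e)) (≡ᵇ-refl (toℕ (φ a))))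
  (λ e → subst (λ z → (toℕ a ≡ᵇ toℕ z) ≡ true) (inj (toℕ-injective (≡ᵇ-true e))) (≡ᵇ-refl (toℕ a)))

isPair-injective : ∀ {A B} (φ : Fin A → Fin B) → (∀ {x y} → φ x ≡ φ y → x ≡ y) → ∀ x y a b →
  isPair (toℕ x) (toℕ y) (toℕ a) (toℕ b) ≡ isPair (toℕ (φ x)) (toℕ (φ y)) (toℕ (φ a)) (toℕ (φ b))
isPair-injective φ inj x y a b
  rewrite ≡ᵇ-injective φ inj a x | ≡ᵇ-injective φ inj b y | ≡ᵇ-injective φ inj a y | ≡ᵇ-injective φ inj b x = refl

restore-edge : ∀ (Γ : Graph) → IsSimple Γ → (e : Edge Γ) → ∀ p q →
  adj Γ p q ≡ adj (deleteEdge Γ e) p q ∨ isPair (toℕ (u e)) (toℕ (v e)) (toℕ p) (toℕ q)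
restore-edge Γ simple e p q = begin
  adj Γ p q                                  ≡⟨ sym (absorb (adj Γ p q) (pair p q) (pair⇒edge p q)) ⟩
  (adj Γ p q ∧ not (pair p q)) ∨ pair p q    ≡⟨ cong (_∨ pair p q) (sym (deleteEdge-adj Γ e p q)) ⟩
  adj (deleteEdge Γ e) p q ∨ pair p q        ∎
  where
  open ≡-Reasoning
  pair : Fin (n Γ) → Fin (n Γ) → Bool
  pair p q = isPair (toℕ (u e)) (toℕ (v e)) (toℕ p) (toℕ q)
  pair⇒edge : ∀ p q → pair p q ≡ true → adj Γ p q ≡ true
  pair⇒edge p q t with isPair-true {toℕ (u e)} {toℕ (v e)} {toℕ p} {toℕ q} t
  ... | inj₁ (a , b) rewrite toℕ-injective {i = p} {j = u e} a | toℕ-injective {i = q} {j = v e} b = isEdge e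
  ... | inj₂ (a , b) rewrite toℕ-injective {i = p} {j = v e} a | toℕ-injective {i = q} {j = u e} b =
    trans (proj₁ simple (v e) (u e)) (isEdge e)

iso-deg : ∀ (Γ Δ : Graph) ((σ , _) : Iso Γ Δ) p → deg Γ p ≡ deg Δ (Inverse.to σ p)
iso-deg Γ Δ (σ , iso) p = begin
  deg Γ p                                            ≡⟨ deg≡count Γ p ⟩
  count (adj Γ p)                                    ≡⟨ count-cong (iso p) ⟩
  count (λ q → adj Δ (Inverse.to σ p) (Inverse.to σ q)) ≡⟨ sym (count-permute σ (adj Δ (Inverse.to σ p))) ⟩
  count (adj Δ (Inverse.to σ p))                     ≡⟨ sym (deg≡count Δ (Inverse.to σ p)) ⟩
  deg Δ (Inverse.to σ p)                             ∎
  where open ≡-Reasoning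

-- The graph kP_L on the numbers 0 … kL-1

∸-suc : ∀ {L r} → r < L → suc (L ∸ suc r) ≡ L ∸ r
∸-suc {L} {r} r<L = sym (+-∸-assoc 1 r<L)

module KPaths (L : ℕ) {{nzL : NonZero L}} where

  -- x ~ x+1 is an edge of kP_L unless x+1 starts a new block
  step : ℕ → ℕ → Bool
  step a b = (suc a ≡ᵇ b) ∧ not (suc a % L ≡ᵇ 0)

  link : ℕ → ℕ → Bool
  link a b = step a b ∨ step b a

  kP : ℕ → Graph
  kP k = copies k (path L)

  kP-size : ∀ k → n (kP k) ≡ k * L
  kP-size zero = refl
  kP-size (suc k) = cong (L +_) (kP-size k)

  step-inside : ∀ x y → y < L → step x y ≡ (suc x ≡ᵇ y)
  step-inside x y y<L with suc x ≡ᵇ y in eq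
  ... | false = refl
  ... | true rewrite m<n⇒m%n≡m {n = L} {m = suc x} (subst (_< L) (sym (≡ᵇ-true eq)) y<L) = refl
  step-out : ∀ x y → x < L → step x (L + y) ≡ false
  step-out x y x<L with suc x ≡ᵇ L + y in eq
  ... | false = refl
  ... | true rewrite ≤-antisym x<L (≤-trans (m≤m+n L y) (≤-reflexive (sym (≡ᵇ-true eq)))) | n%n≡0 L {{nzL}} = refl
  step-in : ∀ x y → x < L → step (L + y) x ≡ false
  step-in x y x<L with suc (L + y) ≡ᵇ x in eq
  ... | false = refl
  ... | true = ⊥-elim (<-irrefl refl
    (≤-trans x<L (≤-trans (m≤m+n L y) (≤-trans (n≤1+n _) (≤-reflexive (≡ᵇ-true eq))))))
  step-shift : ∀ x y → step (L + x) (L + y) ≡ step x y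
  step-shift x y rewrite sym (+-suc L x) | ≡ᵇ-+ L (suc x) y
    | +-comm L (suc x) | [m+n]%n≡m%n (suc x) L {{nzL}} = refl


  kP-adj : ∀ k (i j : Fin (n (kP k))) → adj (kP k) i j ≡ link (toℕ i) (toℕ j)
  kP-adj zero () j
  kP-adj (suc k) i j with splitAt L i in ei | splitAt L j in ej
  ... | inj₁ a | inj₁ b
    rewrite sym (splitAt⁻¹-↑ˡ ei) | sym (splitAt⁻¹-↑ˡ ej)
      | toℕ-↑ˡ a (n (kP k)) | toℕ-↑ˡ b (n (kP k))
      | step-inside (toℕ a) (toℕ b) (toℕ<n b) | step-inside (toℕ b) (toℕ a) (toℕ<n a) = refl
  ... | inj₁ a | inj₂ b
    rewrite sym (splitAt⁻¹-↑ˡ ei) | sym (splitAt⁻¹-↑ʳ ej)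
      | toℕ-↑ˡ a (n (kP k)) | toℕ-↑ʳ L b
      | step-out (toℕ a) (toℕ b) (toℕ<n a) | step-in (toℕ a) (toℕ b) (toℕ<n a) = refl
  ... | inj₂ a | inj₁ b
    rewrite sym (splitAt⁻¹-↑ʳ ei) | sym (splitAt⁻¹-↑ˡ ej)
      | toℕ-↑ʳ L a | toℕ-↑ˡ b (n (kP k))
      | step-out (toℕ b) (toℕ a) (toℕ<n b) | step-in (toℕ b) (toℕ a) (toℕ<n b) = refl
  ... | inj₂ a | inj₂ b
    rewrite sym (splitAt⁻¹-↑ʳ ei) | sym (splitAt⁻¹-↑ʳ ej)
      | toℕ-↑ʳ L a | toℕ-↑ʳ L b
      | step-shift (toℕ a) (toℕ b) | step-shift (toℕ b) (toℕ a) = kP-adj k a b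

  Step : ℕ → ℕ → Set
  Step x y = (y ≡ suc x) × (¬ suc x % L ≡ 0)

  Link : ℕ → ℕ → Set
  Link x y = Step x y ⊎ Step y x

  Link-sym : ∀ {x y} → Link x y → Link y x
  Link-sym (inj₁ p) = inj₂ p
  Link-sym (inj₂ p) = inj₁ p

  step⇒Step : ∀ {a b} → step a b ≡ true → Step a b
  step⇒Step {a} {b} e =
    sym (≡ᵇ-true (∧-l e)) ,
    λ z → t≢f (trans (sym (cong (_≡ᵇ 0) z)) (not-true (∧-r {suc a ≡ᵇ b} e)))

  Step⇒step : ∀ {a b} → Step a b → step a b ≡ true
  Step⇒step {a} (refl , ne) rewrite ≡ᵇ-refl a | ≡ᵇ-false ne = refl

  link⇒Link : ∀ {a b} → link a b ≡ true → Link a b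
  link⇒Link {a} {b} e with ∨-e {step a b} e
  ... | inj₁ p = inj₁ (step⇒Step p)
  ... | inj₂ p = inj₂ (step⇒Step p)

  Link⇒link : ∀ {a b} → Link a b → link a b ≡ true
  Link⇒link (inj₁ p) = ∨-l (Step⇒step p)
  Link⇒link {a} {b} (inj₂ p) = ∨-r {step a b} (Step⇒step p)

  link-sym : ∀ a b → link a b ≡ link b a
  link-sym a b = ∨-comm (step a b) (step b a)

  link-irrefl : ∀ a → link a a ≡ false
  link-irrefl a = not-true⇒false λ e → [ loop , loop ] (link⇒Link e)
    where
    loop : ¬ Step a a
    loop (e , _) = <-irrefl e (n<1+n a)

  -- Paths of kP_L.  A path on K+1 vertices is a sequence a 0, …, a K of
  -- distinct numbers with consecutive entries linked.

  InjectiveUpTo : ℕ → (ℕ → ℕ) → Set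
  InjectiveUpTo K a = ∀ i j → i ≤ K → j ≤ K → a i ≡ a j → i ≡ j

  Ascending : ℕ → (ℕ → ℕ) → Set
  Ascending K a = ∀ i → i < K → Step (a i) (a (suc i))

  Descending : ℕ → (ℕ → ℕ) → Set
  Descending K a = ∀ i → i < K → Step (a (suc i)) (a i)

  steps-stay-in-block : ∀ K a₀ → (∀ i → i < K → ¬ suc (a₀ + i) % L ≡ 0) → a₀ % L + K < L
  steps-stay-in-block K a₀ h with (a₀ % L + K) <? L
  ... | yes p = p
  ... | no np = ⊥-elim (h i i<K crossing)
    where
    r = a₀ % L
    r<L : r < L
    r<L = m%n<n a₀ L
    -- the step from a₀ + i to a₀ + i + 1 reaches the next multiple of L
    i = L ∸ suc r
    si : suc i ≡ L ∸ r
    si = ∸-suc r<L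
    i<K : i < K
    i<K = +-cancelʳ-≤ r (suc i) K
      (subst (_≤ K + r) (sym (trans (cong (_+ r) si) (m∸n+n≡m (<⇒≤ r<L))))
             (subst (L ≤_) (+-comm r K) (≮⇒≥ np)))
    crossing : suc (a₀ + i) % L ≡ 0
    crossing = begin
      suc (a₀ + i) % L                ≡⟨ cong (_% L) (sym (+-suc a₀ i)) ⟩
      (a₀ + suc i) % L                ≡⟨ cong (λ z → (a₀ + z) % L) si ⟩
      (a₀ + (L ∸ r)) % L              ≡⟨ cong (λ z → (z + (L ∸ r)) % L) (m≡m%n+[m/n]*n a₀ L) ⟩
      (r + a₀ / L * L + (L ∸ r)) % L  ≡⟨ cong (_% L) (trans (cong (_+ (L ∸ r)) (+-comm r (a₀ / L * L)))
                                                             (+-assoc (a₀ / L * L) r (L ∸ r))) ⟩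
      (a₀ / L * L + (r + (L ∸ r))) % L ≡⟨ cong (λ z → (a₀ / L * L + z) % L) (m+[n∸m]≡n (<⇒≤ r<L)) ⟩
      (a₀ / L * L + L) % L            ≡⟨ [m+n]%n≡m%n (a₀ / L * L) L ⟩
      (a₀ / L * L) % L                ≡⟨ m*n%n≡0 (a₀ / L) L ⟩
      0                               ∎
      where open ≡-Reasoning

  ascending-values : ∀ K a → Ascending K a → ∀ i → i ≤ K → a i ≡ a 0 + i
  ascending-values K a asc zero _ = sym (+-identityʳ (a 0))
  ascending-values K a asc (suc i) si≤K =
    trans (proj₁ (asc i si≤K))
          (trans (cong suc (ascending-values K a asc i (<⇒≤ si≤K))) (sym (+-suc (a 0) i)))

  ascending-in-block : ∀ K a → Ascending K a → a 0 % L + K < L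
  ascending-in-block K a asc = steps-stay-in-block K (a 0) λ i i<K e →
    proj₂ (asc i i<K) (subst (λ z → suc z % L ≡ 0) (sym (ascending-values K a asc i (<⇒≤ i<K))) e)

  extend-below : (P : ℕ → Set) → ∀ K → (∀ i → i < K → P i) → P K → ∀ i → i < suc K → P i
  extend-below P K f p i i< with m≤n⇒m<n∨m≡n (s≤s⁻¹ i<)
  ... | inj₁ l = f i l
  ... | inj₂ refl = p

  -- a path of kP_L is ascending or descending: it cannot turn back, since
  -- a (K+2) = a K would contradict injectivity
  ascending-or-descending : ∀ K a → InjectiveUpTo K a → (∀ i → i < K → Link (a i) (a (suc i))) →
                            Ascending K a ⊎ Descending K a
  ascending-or-descending zero a _ _ = inj₁ (λ i ())
  ascending-or-descending (suc zero) a _ links with links 0 (s≤s z≤n)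
  ... | inj₁ p = inj₁ λ { zero _ → p ; (suc i) (s≤s ()) }
  ... | inj₂ p = inj₂ λ { zero _ → p ; (suc i) (s≤s ()) }
  ascending-or-descending (suc (suc K)) a inj links
    with ascending-or-descending (suc K) a
           (λ i j i≤ j≤ → inj i j (m≤n⇒m≤1+n i≤) (m≤n⇒m≤1+n j≤)) (λ i i< → links i (m≤n⇒m≤1+n i<))
       | links (suc K) ≤-refl
  ... | inj₁ asc | inj₁ p = inj₁ (extend-below (λ i → Step (a i) (a (suc i))) (suc K) asc p)
  ... | inj₂ dsc | inj₂ p = inj₂ (extend-below (λ i → Step (a (suc i)) (a i)) (suc K) dsc p)
  ... | inj₁ asc | inj₂ p
    with inj (suc (suc K)) K ≤-refl (m≤n⇒m≤1+n (m≤n⇒m≤1+n ≤-refl))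
             (suc-injective (trans (sym (proj₁ p)) (proj₁ (asc K ≤-refl))))
  ... | ()
  ascending-or-descending (suc (suc K)) a inj links | inj₂ dsc | inj₁ p
    with inj (suc (suc K)) K ≤-refl (m≤n⇒m≤1+n (m≤n⇒m≤1+n ≤-refl))
             (trans (proj₁ p) (sym (proj₁ (dsc K ≤-refl))))
  ... | ()

  reverse : ℕ → (ℕ → ℕ) → (ℕ → ℕ)
  reverse K a i = a (K ∸ i)

  reverse-ascending : ∀ K a → Descending K a → Ascending K (reverse K a)
  reverse-ascending K a dsc i i<K = subst (λ z → Step (a z) (a (K ∸ suc i))) (∸-suc i<K)
    (dsc (K ∸ suc i) (∸-monoʳ-< {K} {suc i} {0} (s≤s z≤n) i<K))

  noLongPath : ∀ a → InjectiveUpTo L a → (∀ i → i < L → Link (a i) (a (suc i))) → ⊥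
  noLongPath a inj links =
    [ (λ asc → too-long (ascending-in-block L a asc))
    , (λ dsc → too-long (ascending-in-block L (reverse L a) (reverse-ascending L a dsc))) ]
    (ascending-or-descending L a inj links)
    where
    too-long : ∀ {r} → ¬ r + L < L
    too-long {r} l = <-irrefl refl (≤-trans (s≤s (m≤n+m L r)) l)

  module Blocks (L≥4 : 4 ≤ L) where

    3≤L : 3 ≤ L
    3≤L = ≤-trans (s≤s (s≤s (s≤s z≤n))) L≥4

    2<L : 2 < L
    2<L = 3≤L

    1<L : 1 < L
    1<L = ≤-trans (s≤s (s≤s z≤n)) 3≤L

    mod-small : ∀ {x} → x < L → x % L ≡ x
    mod-small = m<n⇒m%n≡m

    L%L : L % L ≡ 0
    L%L = n%n≡0 L

    0%L : 0 % L ≡ 0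
    0%L = mod-small (<⇒≤ 1<L)

    nonmultiple : ∀ {x} → 0 < x → x < L → ¬ x % L ≡ 0
    nonmultiple {suc x} _ x<L e = 1+n≢0 (trans (sym (mod-small x<L)) e)

    Step01 : Step 0 1
    Step01 = refl , nonmultiple (s≤s z≤n) 1<L

    Step12 : Step 1 2
    Step12 = refl , nonmultiple (s≤s z≤n) 2<L

    offset-in-block : ∀ {c} d → c % L ≡ 0 → d < L → (c + d) % L ≡ d
    offset-in-block {c} d e d<L = begin
      (c + d) % L         ≡⟨ %-distribˡ-+ c d L ⟩
      (c % L + d % L) % L ≡⟨ cong (λ z → (z + d % L) % L) e ⟩
      (d % L) % L         ≡⟨ m%n%n≡m%n d L ⟩
      d % L               ≡⟨ mod-small d<L ⟩
      d                   ∎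
      where open ≡-Reasoning

    block-step : ∀ c j → c % L ≡ 0 → suc j < L → Step (c + j) (c + suc j)
    block-step c j e l = +-suc c j , λ z →
      1+n≢0 (trans (sym (offset-in-block (suc j) e l)) (trans (cong (_% L) (+-suc c j)) z))

    link-row : ∀ c b → link c b ≡
      (((b ≡ᵇ suc c) ∧ not (suc c % L ≡ᵇ 0)) ∨ ((suc b ≡ᵇ c) ∧ not (c % L ≡ᵇ 0)))
    link-row c b with suc b ≡ᵇ c in e
    ... | false rewrite ≡ᵇ-sym (suc c) b = refl
    ... | true = trans (cong (λ z → z ∧ not (suc c % L ≡ᵇ 0) ∨ not (suc b % L ≡ᵇ 0)) (≡ᵇ-sym (suc c) b))
                       (cong (λ z → (b ≡ᵇ suc c) ∧ not (suc c % L ≡ᵇ 0) ∨ not (z % L ≡ᵇ 0)) (≡ᵇ-true e))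

    after-start : ∀ {c} → c % L ≡ 0 → suc c % L ≡ 1
    after-start {c} e = trans (cong (_% L) (+-comm 1 c)) (offset-in-block 1 e 1<L)

    link-at-start : ∀ {c} → c % L ≡ 0 → ∀ b → link c b ≡ (b ≡ᵇ suc c)
    link-at-start {c} e b rewrite link-row c b | after-start e | e
      | ∧-identityʳ (b ≡ᵇ suc c) | ∧-zeroʳ (suc b ≡ᵇ c) | ∨-identityʳ (b ≡ᵇ suc c) = refl

    link-interior : ∀ {c} → ¬ c % L ≡ 0 → ¬ suc c % L ≡ 0 → ∀ b → link c b ≡ (b ≡ᵇ suc c) ∨ (suc b ≡ᵇ c)
    link-interior {c} n₁ n₂ b rewrite link-row c b | ≡ᵇ-false n₁ | ≡ᵇ-false n₂
      | ∧-identityʳ (b ≡ᵇ suc c) | ∧-identityʳ (suc b ≡ᵇ c) = refl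

    step-below-bound : ∀ k x → x < k * L → ¬ suc x % L ≡ 0 → suc x < k * L
    step-below-bound k x x< ne with m≤n⇒m<n∨m≡n x<
    ... | inj₁ l = l
    ... | inj₂ e = ⊥-elim (ne (trans (cong (_% L) e) (m*n%n≡0 k L)))

    -- The graph kP_L minus the edge {1,2} has no component that is a path
    -- on L-1 vertices: such a path lies in one block, and either its first
    -- vertex would also be adjacent to the previous vertex, or its last
    -- vertex to the next one, unless the path is 1 … L-1 or 0 … L-2, which
    -- both use the deleted edge.
    module IsolatedPath (k : ℕ) where

      K : ℕ
      K = L ∸ 2

      L≡K+2 : L ≡ suc (suc K)
      L≡K+2 = sym (m+[n∸m]≡n {2} {L} (≤-trans (s≤s (s≤s z≤n)) L≥4))

      1<K : 1 < K
      1<K = ∸-monoˡ-≤ 2 L≥4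

      Not12 : ℕ → ℕ → Set
      Not12 x y = ¬ (x ≡ 1 × y ≡ 2) × ¬ (x ≡ 2 × y ≡ 1)

      LinkNot12 : ℕ → ℕ → Set
      LinkNot12 x y = Link x y × Not12 x y

      EndsIsolated : (ℕ → ℕ) → Set
      EndsIsolated a =
        (∀ w → w < k * L → LinkNot12 (a 0) w → w ≡ a 1) × (∀ w → w < k * L → LinkNot12 (a K) w → w ≡ a (K ∸ 1))

      large-not12 : ∀ {x y} → 3 ≤ x → Not12 x y
      large-not12 (s≤s (s≤s (s≤s _))) = (λ { (() , _) }) , (λ { (() , _) })

      start-offset≤1 : ∀ a → Ascending K a → a 0 % L ≤ 1
      start-offset≤1 a asc = s≤s⁻¹ (+-cancelʳ-≤ K (suc (a 0 % L)) 2
        (subst (suc (a 0 % L) + K ≤_) L≡K+2 (ascending-in-block K a asc)))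

      offset≤1 : ∀ {x} → x ≤ 1 → x ≡ 0 ⊎ x ≡ 1
      offset≤1 {zero} _ = inj₁ refl
      offset≤1 {suc zero} _ = inj₂ refl
      offset≤1 {suc (suc _)} (s≤s ())

      -- starting at offset 0 of a later block, the last vertex a K has the
      -- further neighbour a K + 1
      at-offset0 : ∀ a → Ascending K a → (∀ i → i ≤ K → a i < k * L) → L ≤ a 0 → a 0 % L ≡ 0 →
                   (∀ w → w < k * L → LinkNot12 (a K) w → w ≡ a (K ∸ 1)) → ⊥
      at-offset0 a asc bound L≤a₀ r0 endK = <-irrefl refl (≤-trans (≤-reflexive next≡prev) prev≤last)
        where
        last≡ : a K ≡ a 0 + K
        last≡ = ascending-values K a asc K ≤-refl
        next-offset : suc (a K) % L ≡ suc K
        next-offset = begin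
          suc (a K) % L     ≡⟨ cong (λ z → suc z % L) last≡ ⟩
          suc (a 0 + K) % L ≡⟨ cong (_% L) (sym (+-suc (a 0) K)) ⟩
          (a 0 + suc K) % L ≡⟨ offset-in-block (suc K) r0 (subst (suc K <_) (sym L≡K+2) ≤-refl) ⟩
          suc K             ∎
          where open ≡-Reasoning
        not-end : ¬ suc (a K) % L ≡ 0
        not-end e = 1+n≢0 (trans (sym next-offset) e)
        3≤last : 3 ≤ a K
        3≤last = ≤-trans 3≤L (≤-trans L≤a₀ (subst (a 0 ≤_) (sym last≡) (m≤m+n (a 0) K)))
        next≡prev : suc (a K) ≡ a (K ∸ 1)
        next≡prev = endK (suc (a K)) (step-below-bound k (a K) (bound K ≤-refl) not-end)
                         (inj₁ (refl , not-end) , large-not12 3≤last)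
        prev≤last : a (K ∸ 1) ≤ a K
        prev≤last = subst₂ _≤_ (sym (ascending-values K a asc (K ∸ 1) (m∸n≤m K 1))) (sym last≡)
                           (+-monoʳ-≤ (a 0) (m∸n≤m K 1))

      -- starting at offset 1 of a later block, the first vertex a 0 has the
      -- further neighbour a 0 - 1
      at-offset1 : ∀ a → Ascending K a → (∀ i → i ≤ K → a i < k * L) → L ≤ a 0 → a 0 % L ≡ 1 →
                   (∀ w → w < k * L → LinkNot12 (a 0) w → w ≡ a 1) → ⊥
      at-offset1 a asc bound L≤a₀ r1 end0 = no-cycle (trans (sym pred-suc) (cong suc (trans prev≡second second≡)))
        where
        no-cycle : ∀ {x} → ¬ x ≡ suc (suc x)
        no-cycle ()
        3≤a₀ : 3 ≤ a 0
        3≤a₀ = ≤-trans 3≤L L≤a₀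
        pred-suc : suc (pred (a 0)) ≡ a 0
        pred-suc = suc-pred (a 0) {{>-nonZero (≤-trans (s≤s z≤n) 3≤a₀)}}
        not-end : ¬ suc (pred (a 0)) % L ≡ 0
        not-end e = 1+n≢0 (trans (sym r1) (trans (cong (_% L) (sym pred-suc)) e))
        prev≡second : pred (a 0) ≡ a 1
        prev≡second = end0 (pred (a 0)) (≤-trans (≤-reflexive pred-suc) (<⇒≤ (bound 0 z≤n)))
                           (inj₂ (sym pred-suc , not-end) , large-not12 3≤a₀)
        second≡ : a 1 ≡ suc (a 0)
        second≡ = trans (ascending-values K a asc 1 (<⇒≤ 1<K)) (+-comm (a 0) 1)

      ascending-not-isolated : ∀ a → Ascending K a → (∀ i → i < K → ¬ (a i ≡ 1 × a (suc i) ≡ 2)) →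
        (∀ i → i ≤ K → a i < k * L) → EndsIsolated a → ⊥
      ascending-not-isolated a asc avoid bound (end0 , endK) with a 0 <? L
      ... | no a₀≮L with offset≤1 (start-offset≤1 a asc)
      ...   | inj₁ r0 = at-offset0 a asc bound (≮⇒≥ a₀≮L) r0 endK
      ...   | inj₂ r1 = at-offset1 a asc bound (≮⇒≥ a₀≮L) r1 end0
      ascending-not-isolated a asc avoid bound _ | yes a₀<L
        with offset≤1 (subst (_≤ 1) (mod-small a₀<L) (start-offset≤1 a asc))
      ... | inj₁ a₀≡0 = avoid 1 1<K (trans (ascending-values K a asc 1 (<⇒≤ 1<K)) (cong (_+ 1) a₀≡0) ,
                                     trans (ascending-values K a asc 2 1<K) (cong (_+ 2) a₀≡0))
      ... | inj₂ a₀≡1 = avoid 0 (≤-trans (s≤s z≤n) 1<K)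
                          (a₀≡1 , trans (ascending-values K a asc 1 (<⇒≤ 1<K)) (cong (_+ 1) a₀≡1))

      noIsolatedPath : ∀ a → InjectiveUpTo K a → (∀ i → i ≤ K → a i < k * L) →
        (∀ i → i < K → LinkNot12 (a i) (a (suc i))) → EndsIsolated a → ⊥
      noIsolatedPath a inj bound links ends with ascending-or-descending K a inj (λ i i< → proj₁ (links i i<))
      ... | inj₁ asc = ascending-not-isolated a asc (λ i i< → proj₁ (proj₂ (links i i<))) bound ends
      ... | inj₂ dsc = ascending-not-isolated (reverse K a) (reverse-ascending K a dsc) avoid
                         (λ i i≤ → bound (K ∸ i) (m∸n≤m K i)) (proj₂ ends , end0')
        where
        avoid : ∀ i → i < K → ¬ (a (K ∸ i) ≡ 1 × a (K ∸ suc i) ≡ 2)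
        avoid i i< (p , q) = proj₂ (proj₂ (links (K ∸ suc i) (∸-monoʳ-< {K} {suc i} {0} (s≤s z≤n) i<)))
                               (q , subst (λ z → a z ≡ 1) (sym (∸-suc i<)) p)
        end0' : ∀ w → w < k * L → LinkNot12 (a (K ∸ K)) w → w ≡ a (K ∸ (K ∸ 1))
        end0' w w< l = subst (w ≡_) (cong a (sym (m∸[m∸n]≡n (<⇒≤ 1<K))))
                         (proj₁ ends w w< (subst (λ z → LinkNot12 (a z) w) (n∸n≡0 K) l))

    minus01 : ℕ → ℕ → Bool
    minus01 a b = link a b ∧ not (isPair 0 1 a b)

    minus12 : ℕ → ℕ → Bool
    minus12 a b = link a b ∧ not (isPair 1 2 a b)

    minus01-sym : ∀ a b → minus01 a b ≡ minus01 b a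
    minus01-sym a b rewrite link-sym a b | isPair-flip 0 1 a b = refl

    minus01-intro : ∀ a b → link a b ≡ true → ¬ (a ≡ 0 × b ≡ 1) → ¬ (a ≡ 1 × b ≡ 0) → minus01 a b ≡ true
    minus01-intro a b e h₁ h₂ = and-not (isPair 0 1 a b) e (isPair-false h₁ h₂)

    minus01-neighbour : ∀ c → ¬ c ≡ 0 →
      Σ ℕ λ b → minus01 c b ≡ true × (b < c ⊎ (b ≡ suc c × ¬ suc c % L ≡ 0))
    minus01-neighbour zero nz = ⊥-elim (nz refl)
    minus01-neighbour (suc zero) _ =
      2 , minus01-intro 1 2 (Link⇒link (inj₁ Step12)) (λ { (() , _) }) (λ { (_ , ()) }) , inj₂ (refl , proj₂ Step12)
    minus01-neighbour (suc (suc c)) _ with suc (suc c) % L ≟ 0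
    ... | no ne = suc c , minus01-intro (suc (suc c)) (suc c) (Link⇒link (inj₂ (refl , ne)))
                            (λ { (() , _) }) (λ { (() , _) }) , inj₁ ≤-refl
    ... | yes e = suc (suc (suc c)) , minus01-intro (suc (suc c)) (suc (suc (suc c))) (Link⇒link (inj₁ (refl , ne)))
                                        (λ { (() , _) }) (λ { (() , _) }) , inj₂ (refl , ne)
      where
      ne : ¬ suc (suc (suc c)) % L ≡ 0
      ne z = 1+n≢0 (trans (sym (after-start e)) z)

    minus01-both-neighbours : ∀ c → ¬ c ≡ 0 → ¬ c ≡ 1 → ¬ c % L ≡ 0 → ¬ suc c % L ≡ 0 →
                              minus01 c (pred c) ≡ true × minus01 c (suc c) ≡ true
    minus01-both-neighbours zero n0 _ _ _ = ⊥-elim (n0 refl)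
    minus01-both-neighbours (suc zero) _ n1 _ _ = ⊥-elim (n1 refl)
    minus01-both-neighbours (suc (suc c)) _ _ m₁ m₂ =
      minus01-intro (suc (suc c)) (suc c) (Link⇒link (inj₂ (refl , m₁))) (λ { (() , _) }) (λ { (() , _) }) ,
      minus01-intro (suc (suc c)) (suc (suc (suc c))) (Link⇒link (inj₁ (refl , m₂))) (λ { (() , _) }) (λ { (() , _) })

    minus01-block-step : ∀ c i → c % L ≡ 0 → L ≤ c → suc i < L → minus01 (c + i) (c + suc i) ≡ true
    minus01-block-step c i e L≤c si<L =
      minus01-intro (c + i) (c + suc i) (Link⇒link (inj₁ (block-step c i e si<L)))
        (λ { (x , _) → <-irrefl (sym x) (≤-trans (<⇒≤ 1<L) (≤-trans L≤c (m≤m+n c i))) })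
        (λ { (x , _) → <-irrefl (sym x) (≤-trans 1<L (≤-trans L≤c (m≤m+n c i))) })

    -- kP_L - {0,1} + {0,w}: the graph a reconstruction from the first card must be
    reattach : ℕ → ℕ → ℕ → Bool
    reattach w a b = minus01 a b ∨ isPair 0 w a b

    reattach-sym : ∀ w a b → reattach w a b ≡ reattach w b a
    reattach-sym w a b rewrite minus01-sym a b | isPair-flip 0 w a b = refl

    reattach-1 : ∀ a b → reattach 1 a b ≡ link a b
    reattach-1 a b = absorb (link a b) (isPair 0 1 a b) is-edge
      where
      is-edge : isPair 0 1 a b ≡ true → link a b ≡ true
      is-edge e with isPair-true {0} {1} {a} {b} e
      ... | inj₁ (refl , refl) = Link⇒link (inj₁ Step01)
      ... | inj₂ (refl , refl) = Link⇒link (inj₂ Step01)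

    -- Reattaching at w = L-1 gives kP_L again, up to the reflection c ↦ L - c
    -- of 1 … L-1 (fixing 0 and the other blocks).

    reflect : ℕ → ℕ
    reflect zero = zero
    reflect (suc a) with suc a <? L
    ... | yes _ = L ∸ suc a
    ... | no _ = suc a

    reflect-inside : ∀ c → suc c < L → reflect (suc c) ≡ L ∸ suc c
    reflect-inside c l with suc c <? L
    ... | yes _ = refl
    ... | no n = ⊥-elim (n l)

    reflect-outside : ∀ a → L ≤ a → reflect a ≡ a
    reflect-outside zero l = ⊥-elim (<-irrefl refl (≤-trans (s≤s z≤n) (≤-trans 1<L l)))
    reflect-outside (suc a) l with suc a <? L
    ... | yes p = ⊥-elim (<-irrefl refl (≤-trans p l))
    ... | no _ = refl

    L∸≢0 : ∀ {c} → c < L → ¬ L ∸ c ≡ 0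
    L∸≢0 l e = <-irrefl refl (subst (0 <_) e (m<n⇒0<n∸m l))

    reflect-small : ∀ a → a < L → reflect a < L
    reflect-small zero l = l
    reflect-small (suc c) l rewrite reflect-inside c l = ∸-monoʳ-< {L} {suc c} {0} (s≤s z≤n) (<⇒≤ l)

    reflect-involutive : ∀ a → reflect (reflect a) ≡ a
    reflect-involutive zero = refl
    reflect-involutive (suc a) with suc a <? L
    ... | no n = reflect-outside (suc a) (≮⇒≥ n)
    ... | yes p with L ∸ suc a in e
    ...   | zero = ⊥-elim (L∸≢0 p e)
    ...   | suc d = trans (reflect-inside d d<L) (trans (cong (L ∸_) (sym e)) (m∸[m∸n]≡n (<⇒≤ p)))
      where
      d<L : suc d < L
      d<L = subst (_< L) e (∸-monoʳ-< {L} {suc a} {0} (s≤s z≤n) (<⇒≤ p))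

    reflect-last : reflect (L ∸ 1) ≡ 1
    reflect-last = begin
      reflect (L ∸ 1)         ≡⟨ cong reflect (sym (∸-suc 1<L)) ⟩
      reflect (suc (L ∸ 2))   ≡⟨ reflect-inside (L ∸ 2) (subst (_< L) (sym (∸-suc 1<L)) (∸-monoʳ-< {L} {1} {0} (s≤s z≤n) (<⇒≤ 1<L))) ⟩
      L ∸ suc (L ∸ 2)         ≡⟨ cong (L ∸_) (∸-suc 1<L) ⟩
      L ∸ (L ∸ 1)             ≡⟨ m∸[m∸n]≡n {L} {1} (<⇒≤ 1<L) ⟩
      1                       ∎
      where open ≡-Reasoning

    below-L : ∀ {x} → x ≤ L → ¬ x % L ≡ 0 → x < L
    below-L l ne with m≤n⇒m<n∨m≡n l
    ... | inj₁ q = q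
    ... | inj₂ refl = ⊥-elim (ne L%L)

    Step-reflected : ∀ c → suc (suc c) < L → Step (L ∸ suc (suc c)) (L ∸ suc c)
    Step-reflected c l = sym (∸-suc (<⇒≤ l)) , λ z → L∸≢0 {suc c} (<⇒≤ l)
        (trans (sym (mod-small lt)) (trans (cong (_% L) (sym (∸-suc (<⇒≤ l)))) z))
      where
      lt : L ∸ suc c < L
      lt = ∸-monoʳ-< {L} {suc c} {0} (s≤s z≤n) (<⇒≤ (<⇒≤ l))

    reflect-Step : ∀ a b → Step a b → ¬ (a ≡ 0 × b ≡ 1) → Link (reflect a) (reflect b)
    reflect-Step a .(suc a) (refl , ne) not01 with a <? L
    ... | no a≮L rewrite reflect-outside a (≮⇒≥ a≮L) | reflect-outside (suc a) (≤-trans (≮⇒≥ a≮L) (n≤1+n a)) =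
          inj₁ (refl , ne)
    reflect-Step zero .1 (refl , _) not01 | yes _ = ⊥-elim (not01 (refl , refl))
    reflect-Step (suc c) .(suc (suc c)) (refl , ne) _ | yes a<L
      rewrite reflect-inside c a<L | reflect-inside (suc c) (below-L a<L ne) = inj₂ (Step-reflected c (below-L a<L ne))

    reflect-Step⁻ : ∀ a b → Step a b → reattach (L ∸ 1) (reflect a) (reflect b) ≡ true
    reflect-Step⁻ a .(suc a) (refl , ne) with a <? L
    ... | no a≮L rewrite reflect-outside a (≮⇒≥ a≮L) | reflect-outside (suc a) (≤-trans (≮⇒≥ a≮L) (n≤1+n a)) =
          ∨-l (minus01-intro a (suc a) (Link⇒link (inj₁ (refl , ne)))
                 (λ { (x , _) → <-irrefl (sym x) (≤-trans (<⇒≤ 1<L) (≮⇒≥ a≮L)) })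
                 (λ { (x , _) → <-irrefl (sym x) (≤-trans 1<L (≮⇒≥ a≮L)) }))
    reflect-Step⁻ zero .1 (refl , _) | yes _ rewrite reflect-inside 0 1<L =
      ∨-r {minus01 0 (L ∸ 1)} (isPair-xy 0 (L ∸ 1))
    reflect-Step⁻ (suc c) .(suc (suc c)) (refl , ne) | yes a<L
      rewrite reflect-inside c a<L | reflect-inside (suc c) (below-L a<L ne) =
        ∨-l (minus01-intro (L ∸ suc c) (L ∸ suc (suc c)) (Link⇒link (inj₂ (Step-reflected c (below-L a<L ne))))
               (λ { (x , _) → L∸≢0 a<L x }) (λ { (_ , y) → L∸≢0 (below-L a<L ne) y }))

    reattach-last⇒link : ∀ a b → reattach (L ∸ 1) a b ≡ true → link (reflect a) (reflect b) ≡ true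
    reattach-last⇒link a b e with ∨-e {minus01 a b} e
    ... | inj₂ p with isPair-true {0} {L ∸ 1} {a} {b} p
    ...   | inj₁ (refl , refl) rewrite reflect-last = Link⇒link (inj₁ Step01)
    ...   | inj₂ (refl , refl) rewrite reflect-last = Link⇒link (inj₂ Step01)
    reattach-last⇒link a b e | inj₁ p
      with link⇒Link (∧-l p) | isPair-false⁻ {0} {1} {a} {b} (not-true (∧-r {link a b} p))
    ... | inj₁ s | n₁ , _ = Link⇒link (reflect-Step a b s n₁)
    ... | inj₂ s | _ , n₂ = Link⇒link (Link-sym (reflect-Step b a s (λ { (x , y) → n₂ (y , x) })))

    link⇒reattach-last : ∀ a b → link a b ≡ true → reattach (L ∸ 1) (reflect a) (reflect b) ≡ true
    link⇒reattach-last a b e with link⇒Link e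
    ... | inj₁ s = reflect-Step⁻ a b s
    ... | inj₂ s = trans (reattach-sym (L ∸ 1) (reflect a) (reflect b)) (reflect-Step⁻ b a s)

    reattach-last≡reflected : ∀ a b → reattach (L ∸ 1) a b ≡ link (reflect a) (reflect b)
    reattach-last≡reflected a b = bool-ext (reattach-last⇒link a b)
      (λ e → subst₂ (λ x y → reattach (L ∸ 1) x y ≡ true) (reflect-involutive a) (reflect-involutive b)
                    (link⇒reattach-last (reflect a) (reflect b) e))

    -- Deleting a further edge {s,t} from kP_L - {0,1} + {0,w}.  If s and t
    -- avoid 1 … L-1, the path 1 … L-1 survives, and when L ≤ w its ends
    -- 1 and L-1 have no other neighbours.

    reattach-minus : ℕ → ℕ → ℕ → ℕ → ℕ → Bool
    reattach-minus w s t a b = reattach w a b ∧ not (isPair s t a b)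

    Outside1toL : ℕ → Set
    Outside1toL x = x ≡ 0 ⊎ L ≤ x

    outside-distinct : ∀ {a x} → 1 ≤ a → a < L → Outside1toL x → ¬ a ≡ x
    outside-distinct 1≤a _ (inj₁ refl) refl = <-irrefl refl 1≤a
    outside-distinct _ a<L (inj₂ L≤x) refl = <-irrefl refl (≤-trans a<L L≤x)

    reattach-minus-step : ∀ w s t a → Outside1toL s → Outside1toL t → 1 ≤ a → suc a < L →
                          reattach-minus w s t a (suc a) ≡ true
    reattach-minus-step w s t a out-s out-t 1≤a sa<L =
      and-not (isPair s t a (suc a))
        (∨-l (minus01-intro a (suc a) (Link⇒link (inj₁ (refl , nonmultiple (s≤s z≤n) sa<L)))
           (λ { (x , _) → <-irrefl (sym x) 1≤a }) (λ { (_ , ()) })))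
        (isPair-false {s} {t} {a} {suc a} (λ { (x , _) → outside-distinct 1≤a (<⇒≤ sa<L) out-s x })
                                      (λ { (x , _) → outside-distinct 1≤a (<⇒≤ sa<L) out-t x }))

    reattach-minus-end1 : ∀ w s t c → L ≤ w → reattach-minus w s t 1 c ≡ true → c ≡ 2
    reattach-minus-end1 w s t c L≤w e with ∨-e {minus01 1 c} (∧-l e)
    ... | inj₂ p with isPair-true {0} {w} {1} {c} p
    ...   | inj₁ (() , _)
    ...   | inj₂ (x , _) = ⊥-elim (<-irrefl x (≤-trans 1<L L≤w))
    reattach-minus-end1 w s t c L≤w e | inj₁ p with link⇒Link (∧-l p)
    ... | inj₁ (q , _) = q
    ... | inj₂ (q , _) = ⊥-elim (proj₂ (isPair-false⁻ {0} {1} {1} {c} (not-true (∧-r {link 1 c} p)))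
                                       (refl , suc-injective (sym q)))

    reattach-minus-endL : ∀ w s t c → L ≤ w → reattach-minus w s t (L ∸ 1) c ≡ true → c ≡ L ∸ 2
    reattach-minus-endL w s t c L≤w e with ∨-e {minus01 (L ∸ 1) c} (∧-l e)
    ... | inj₂ p with isPair-true {0} {w} {L ∸ 1} {c} p
    ...   | inj₁ (x , _) = ⊥-elim (L∸≢0 {1} 1<L x)
    ...   | inj₂ (x , _) = ⊥-elim (<-irrefl refl
              (≤-trans (subst (_< L) x (∸-monoʳ-< {L} {1} {0} (s≤s z≤n) (<⇒≤ 1<L))) L≤w))
    reattach-minus-endL w s t c L≤w e | inj₁ p with link⇒Link (∧-l p)
    ... | inj₁ (_ , ne) = ⊥-elim (ne (subst (λ z → z % L ≡ 0) (sym (∸-suc {L} {0} (<⇒≤ 1<L))) L%L))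
    ... | inj₂ (q , _) = suc-injective (trans (sym q) (sym (∸-suc 1<L)))

    module TheGraph (k' : ℕ) where

      k : ℕ
      k = suc (suc k')

      G : Graph
      G = kP k

      N : ℕ
      N = n G

      2L≤N : L + L ≤ N
      2L≤N = subst (L + L ≤_) (sym (kP-size k)) (+-monoʳ-≤ L (m≤m+n L (k' * L)))

      L<N : L < N
      L<N = <-≤-trans (m<m+n L (<⇒≤ 1<L)) 2L≤N

      0<N : 0 < N
      0<N = ≤-trans (s≤s z≤n) L<N

      instance
        nonZeroN : NonZero N
        nonZeroN = >-nonZero 0<N

      vertex : ℕ → Fin N
      vertex x = fromℕ< (m%n<n x N)

      vertex-value : ∀ {x} → x < N → toℕ (vertex x) ≡ x
      vertex-value {x} l = trans (toℕ-fromℕ< (m%n<n x N)) (m<n⇒m%n≡m l)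

      step-below-N : ∀ x → x < N → ¬ suc x % L ≡ 0 → suc x < N
      step-below-N x l ne = subst (suc x <_) (sym (kP-size k))
        (step-below-bound k x (subst (x <_) (kP-size k) l) ne)

      G-adj : ∀ i j → adj G i j ≡ link (toℕ i) (toℕ j)
      G-adj = kP-adj k

      degree : ℕ → ℕ
      degree c = count (λ (j : Fin N) → link c (toℕ j))

      G-deg : ∀ i → deg G i ≡ degree (toℕ i)
      G-deg i = trans (deg≡count G i) (count-cong (G-adj i))

      δ-value : ∀ {c} → c < N → ∀ j → δ (vertex c) j ≡ (toℕ j ≡ᵇ c)
      δ-value l j = trans (≟F-toℕ j (vertex _)) (cong (toℕ j ≡ᵇ_) (vertex-value l))

      count-value : ∀ (f : Fin N → Bool) c → c < N → (∀ j → f j ≡ (toℕ j ≡ᵇ c)) → count f ≡ 1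
      count-value f c l e = trans (count-cong λ j → trans (e j) (sym (δ-value l j))) (count-δ (vertex c))

      vertex-injective : ∀ {x y} → x < N → y < N → vertex x ≡ vertex y → x ≡ y
      vertex-injective lx ly e = trans (sym (vertex-value lx)) (trans (cong toℕ e) (vertex-value ly))

      count-values : ∀ (f : Fin N → Bool) c₁ c₂ → ¬ c₁ ≡ c₂ → c₁ < N → c₂ < N →
                     (∀ j → f j ≡ (toℕ j ≡ᵇ c₁) ∨ (toℕ j ≡ᵇ c₂)) → count f ≡ 2
      count-values f c₁ c₂ ne l₁ l₂ e =
        trans (count-cong λ j → trans (e j) (sym (cong₂ _∨_ (δ-value l₁ j) (δ-value l₂ j))))
              (count-δ₂ (λ x → ne (vertex-injective l₁ l₂ x)))

      count-values≥2 : ∀ (f : Fin N → Bool) b₁ b₂ → ¬ b₁ ≡ b₂ → b₁ < N → b₂ < N →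
                       f (vertex b₁) ≡ true → f (vertex b₂) ≡ true → 2 ≤ count f
      count-values≥2 f b₁ b₂ ne l₁ l₂ =
        count≥2 (vertex b₁) (vertex b₂) (λ x → ne (vertex-injective l₁ l₂ x))

      transport-path : (Fa Gb : ℕ → ℕ → Bool) (σ : Fin N ↔ Fin N) →
        (∀ i j → Fa (toℕ i) (toℕ j) ≡ Gb (toℕ (Inverse.to σ i)) (toℕ (Inverse.to σ j))) →
        ∀ K a → (∀ i → i ≤ K → a i < N) → InjectiveUpTo K a → (∀ i → i < K → Fa (a i) (a (suc i)) ≡ true) →
        InjectiveUpTo K (λ i → toℕ (Inverse.to σ (vertex (a i)))) ×
        (∀ i → i < K → Gb (toℕ (Inverse.to σ (vertex (a i)))) (toℕ (Inverse.to σ (vertex (a (suc i))))) ≡ true)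
      transport-path Fa Gb σ iso K a bound inj links =
        (λ i j i≤ j≤ e → inj i j i≤ j≤
           (vertex-injective (bound i i≤) (bound j j≤) (to-injective σ (toℕ-injective e)))) ,
        (λ i i< → trans (sym (iso (vertex (a i)) (vertex (a (suc i)))))
                        (subst₂ (λ x y → Fa x y ≡ true) (sym (vertex-value (bound i (<⇒≤ i<))))
                                (sym (vertex-value (bound (suc i) i<))) (links i i<)))

      graphOf : (ℕ → ℕ → Bool) → Graph
      graphOf R = mkGraph N (λ i j → R (toℕ i) (toℕ j))

      graphOf-deg : ∀ R c → c < N → deg (graphOf R) (vertex c) ≡ count (λ (j : Fin N) → R c (toℕ j))
      graphOf-deg R c l = trans (deg≡count (graphOf R) (vertex c))
                                (cong (λ x → count (λ (j : Fin N) → R x (toℕ j))) (vertex-value l))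

      edge-between : ∀ R a b → (∀ x y → R x y ≡ R y x) → a < N → b < N → a < b ⊎ b < a → R a b ≡ true →
        Σ (Edge (graphOf R)) λ ε → (∀ x y → isPair (toℕ (u ε)) (toℕ (v ε)) x y ≡ isPair a b x y) ×
                                  (∀ (d : Fin N → ℕ) → d (u ε) + d (v ε) ≡ d (vertex a) + d (vertex b))
      edge-between R a b sym-R a<N b<N (inj₁ a<b) Rab =
        mkEdge (vertex a) (vertex b) (subst₂ _<_ (sym (vertex-value a<N)) (sym (vertex-value b<N)) a<b)
               (subst₂ (λ p q → R p q ≡ true) (sym (vertex-value a<N)) (sym (vertex-value b<N)) Rab) ,
        (λ x y → cong₂ (λ p q → isPair p q x y) (vertex-value a<N) (vertex-value b<N)) , (λ _ → refl)
      edge-between R a b sym-R a<N b<N (inj₂ b<a) Rab =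
        mkEdge (vertex b) (vertex a) (subst₂ _<_ (sym (vertex-value b<N)) (sym (vertex-value a<N)) b<a)
               (subst₂ (λ p q → R p q ≡ true) (sym (vertex-value b<N)) (sym (vertex-value a<N)) (trans (sym-R b a) Rab)) ,
        (λ x y → trans (cong₂ (λ p q → isPair p q x y) (vertex-value b<N) (vertex-value a<N)) (isPair-swap b a x y)) ,
        (λ d → +-comm (d (vertex b)) (d (vertex a)))

      OutsideBlock : ℕ → ℕ → Set
      OutsideBlock z x = x < z ⊎ z + L ≤ x

      outside-block : ∀ {z x} j → OutsideBlock z x → j < L → ¬ x ≡ z + j
      outside-block {z} j (inj₁ l) _ refl = <-irrefl refl (≤-trans l (m≤m+n z j))
      outside-block {z} j (inj₂ l) jl refl = <-irrefl refl (≤-trans (+-monoʳ-< z jl) l)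

      -- The empty multiset is contained in the deck of the empty graph.
      no-empty-determination : ∀ (f : Fin 0 → Edge G) → ¬ Determines G 0 f
      no-empty-determination f det = det empty ((λ ()) , (λ ())) not-iso ((λ ()) , (λ {x} → ⊥-elim (no-vertex x)) , (λ ()))
        where
        empty : Graph
        empty = mkGraph 0 (λ ())
        no-vertex : Fin 0 → ⊥
        no-vertex ()
        not-iso : ¬ Iso empty G
        not-iso (σ , _) = no-vertex (Inverse.from σ (vertex 0))

      -- Let e = XY be an edge with X → Y a step,
      -- {A, B} = {X, Y} with B an interior vertex of its block, and z the start
      -- of a block containing neither X nor Y.  Then H = G - XY + Az has the
      -- card (G - e, d(e)) but contains the path A, z, z+1, …, z+L-1.
      module MovedEdge (e : Edge G) (A B z : ℕ) (XY-step : Step (toℕ (u e)) (toℕ (v e)))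
          (choice : (A ≡ toℕ (u e) × B ≡ toℕ (v e)) ⊎ (A ≡ toℕ (v e) × B ≡ toℕ (u e)))
          (B-not-start : ¬ B % L ≡ 0) (B-not-end : ¬ suc B % L ≡ 0)
          (z-start : z % L ≡ 0) (z-block : z + L ≤ N)
          (X-outside : OutsideBlock z (toℕ (u e))) (Y-outside : OutsideBlock z (toℕ (v e))) where

        X Y : ℕ
        X = toℕ (u e)
        Y = toℕ (v e)

        X≢Y : ¬ X ≡ Y
        X≢Y q = <-irrefl (trans q (proj₁ XY-step)) (n<1+n X)

        by-choice : ∀ {ℓ} (P : ℕ → ℕ → Set ℓ) → P X Y → P Y X → P A B
        by-choice P pxy pyx = [ (λ { (p , q) → subst₂ P (sym p) (sym q) pxy })
                              , (λ { (p , q) → subst₂ P (sym p) (sym q) pyx }) ] choice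

        for-A : ∀ {ℓ} (P : ℕ → Set ℓ) → P X → P Y → P A
        for-A P px py = by-choice (λ a _ → P a) px py

        for-B : ∀ {ℓ} (P : ℕ → Set ℓ) → P X → P Y → P B
        for-B P px py = by-choice (λ _ b → P b) py px

        A-outside : OutsideBlock z A
        A-outside = for-A (OutsideBlock z) X-outside Y-outside

        A<N : A < N
        A<N = for-A (_< N) (toℕ<n (u e)) (toℕ<n (v e))

        B<N : B < N
        B<N = for-B (_< N) (toℕ<n (u e)) (toℕ<n (v e))

        z<N : z < N
        z<N = <-≤-trans (m<m+n z (<⇒≤ 1<L)) z-block

        z-outside : ∀ {x} → OutsideBlock z x → ¬ x ≡ z
        z-outside o q = outside-block 0 o (≤-trans (s≤s z≤n) 1<L) (trans q (sym (+-identityʳ z)))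

        A≢z : ¬ A ≡ z
        A≢z = z-outside A-outside

        AB-edge : link A B ≡ true
        AB-edge = by-choice (λ a b → link a b ≡ true) (Link⇒link (inj₁ XY-step)) (Link⇒link (inj₂ XY-step))

        not-linked-to-z : ∀ {a} → OutsideBlock z a → link a z ≡ false
        not-linked-to-z {a} o = not-true⇒false λ e → [ from-below , from-above ] (link⇒Link e)
          where
          from-below : Step a z → ⊥
          from-below (q , ne) = ne (trans (cong (_% L) (sym q)) z-start)
          from-above : Step z a → ⊥
          from-above (q , _) = outside-block 1 o 1<L (trans q (sym (trans (+-suc z 0) (cong suc (+-identityʳ z)))))

        moved : ℕ → ℕ → Bool
        moved a b = (link a b ∧ not (isPair X Y a b)) ∨ isPair A z a b

        H : Graph
        H = graphOf moved

        moved-sym : ∀ a b → moved a b ≡ moved b a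
        moved-sym a b rewrite link-sym a b | isPair-flip X Y a b | isPair-flip A z a b = refl

        H-simple : IsSimple H
        H-simple = (λ i j → moved-sym (toℕ i) (toℕ j)) , λ i → loopless (toℕ i)
          where
          loopless : ∀ a → moved a a ≡ false
          loopless a rewrite link-irrefl a = not-true⇒false λ e →
            [ (λ { (p , q) → A≢z (trans (sym p) q) }) , (λ { (p , q) → A≢z (trans (sym q) p) }) ]
            (isPair-true {A} {z} {a} {a} e)

        Az : Σ (Edge H) λ ε → (∀ x y → isPair (toℕ (u ε)) (toℕ (v ε)) x y ≡ isPair A z x y) ×
                              (∀ (d : Fin N → ℕ) → d (u ε) + d (v ε) ≡ d (vertex A) + d (vertex z))
        Az = edge-between moved A z moved-sym A<N z<N
               ([ inj₁ , (λ zL≤A → inj₂ (<-≤-trans (m<m+n z (<⇒≤ 1<L)) zL≤A)) ] A-outside)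
               (∨-r {link A z ∧ not (isPair X Y A z)} (isPair-xy A z))

        e′ : Edge H
        e′ = proj₁ Az

        same-card : ∀ i j → adj (deleteEdge H e′) i j ≡ adj (deleteEdge G e) i j
        same-card i j = begin
          adj (deleteEdge H e′) i j
            ≡⟨ deleteEdge-adj H e′ i j ⟩
          moved a b ∧ not (isPair (toℕ (u e′)) (toℕ (v e′)) a b)
            ≡⟨ cong (λ p → moved a b ∧ not p) (proj₁ (proj₂ Az) a b) ⟩
          moved a b ∧ not (isPair A z a b)
            ≡⟨ drop-added (link a b ∧ not (isPair X Y a b)) (isPair A z a b) not-in-G ⟩
          link a b ∧ not (isPair X Y a b)
            ≡⟨ cong (λ p → p ∧ not (isPair X Y a b)) (sym (G-adj i j)) ⟩
          adj G i j ∧ not (isPair X Y a b)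
            ≡⟨ sym (deleteEdge-adj G e i j) ⟩
          adj (deleteEdge G e) i j ∎
          where
          open ≡-Reasoning
          a = toℕ i
          b = toℕ j
          not-in-G : isPair A z a b ≡ true → link a b ∧ not (isPair X Y a b) ≡ false
          not-in-G p with isPair-true {A} {z} {a} {b} p
          ... | inj₁ (refl , refl) rewrite not-linked-to-z A-outside = refl
          ... | inj₂ (refl , refl) rewrite link-sym z A | not-linked-to-z A-outside = refl

        -- z has degree 2 in H: neighbours z + 1 and A
        deg-z : deg H (vertex z) ≡ 2
        deg-z = trans (graphOf-deg moved z z<N)
          (count-values (λ (j : Fin N) → moved z (toℕ j)) (suc z) A z+1≢A z+1<N A<N (λ j → row (toℕ j)))
          where
          z+1≢A : ¬ suc z ≡ A
          z+1≢A q = outside-block 1 A-outside 1<L (trans (sym q) (trans (cong suc (sym (+-identityʳ z))) (sym (+-suc z 0))))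
          z+1<N : suc z < N
          z+1<N = <-≤-trans (subst (_< z + L) (trans (+-suc z 0) (cong suc (+-identityʳ z))) (+-monoʳ-< z 1<L)) z-block
          row : ∀ b → moved z b ≡ (b ≡ᵇ suc z) ∨ (b ≡ᵇ A)
          row b rewrite isPair-false {X} {Y} {z} {b} (λ { (p , _) → z-outside X-outside (sym p) })
                                                     (λ { (p , _) → z-outside Y-outside (sym p) })
                      | link-at-start z-start b | isPair-at₂ {A} {z} A≢z b =
            cong (_∨ (b ≡ᵇ A)) (∧-identityʳ (b ≡ᵇ suc z))

        -- A keeps its degree: it loses B and gains z
        deg-A : deg H (vertex A) ≡ degree A
        deg-A = begin
          deg H (vertex A)                        ≡⟨ graphOf-deg moved A A<N ⟩
          count (λ (j : Fin N) → moved A (toℕ j)) ≡⟨ count-cong row-H ⟩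
          count (λ j → others j ∨ is z j)         ≡⟨ count-∨ others (is z) others-not-z ⟩
          count others + count (is z)             ≡⟨ cong (count others +_) (trans (count-value (is z) z z<N (λ _ → refl))
                                                             (sym (count-value (is B) B B<N (λ _ → refl)))) ⟩
          count others + count (is B)             ≡⟨ sym (count-∨ others (is B) others-not-B) ⟩
          count (λ j → others j ∨ is B j)         ≡⟨ count-cong row-G ⟩
          degree A                                ∎
          where
          open ≡-Reasoning
          is : ℕ → Fin N → Bool
          is c j = toℕ j ≡ᵇ c
          others : Fin N → Bool
          others j = link A (toℕ j) ∧ not (toℕ j ≡ᵇ B)
          XY-at-A : ∀ b → isPair X Y A b ≡ (b ≡ᵇ B)
          XY-at-A b = by-choice (λ a c → isPair X Y a b ≡ (b ≡ᵇ c)) (isPair-at₁ X≢Y b) (isPair-at₂ X≢Y b)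
          row-H : ∀ j → moved A (toℕ j) ≡ others j ∨ (toℕ j ≡ᵇ z)
          row-H j rewrite XY-at-A (toℕ j) | isPair-at₁ {A} {z} A≢z (toℕ j) = refl
          row-G : ∀ j → others j ∨ (toℕ j ≡ᵇ B) ≡ link A (toℕ j)
          row-G j = absorb (link A (toℕ j)) (toℕ j ≡ᵇ B) (λ q → subst (λ b → link A b ≡ true) (sym (≡ᵇ-true q)) AB-edge)
          others-not-z : ∀ j → others j ≡ true → (toℕ j ≡ᵇ z) ≡ true → ⊥
          others-not-z j o q = true≢false (subst (λ b → link A b ≡ true) (≡ᵇ-true {toℕ j} {z} q) (∧-l o))
                                          (not-linked-to-z A-outside)
          others-not-B : ∀ j → others j ≡ true → (toℕ j ≡ᵇ B) ≡ true → ⊥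
          others-not-B j o q = true≢false q (not-true (∧-r {link A (toℕ j)} o))

        deg-B : degree B ≡ 2
        deg-B = count-values (λ (j : Fin N) → link B (toℕ j)) (suc B) (pred B) B+1≢B-1
                  (step-below-N B B<N B-not-end) (≤-<-trans pred[n]≤n B<N)
                  (λ j → trans (link-interior B-not-start B-not-end (toℕ j))
                               (cong ((toℕ j ≡ᵇ suc B) ∨_) (suc-≡ᵇ (toℕ j) B B≢0)))
          where
          B≢0 : ¬ B ≡ 0
          B≢0 q = B-not-start (trans (cong (_% L) q) 0%L)
          B+1≢B-1 : ¬ suc B ≡ pred B
          B+1≢B-1 q = <-irrefl (sym q) (≤-<-trans pred[n]≤n (n<1+n B))

        same-edge-degree : edeg H e′ ≡ edeg G e
        same-edge-degree = begin
          deg H (u e′) + deg H (v e′) ∸ 2           ≡⟨ cong (_∸ 2) (proj₂ (proj₂ Az) (deg H)) ⟩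
          deg H (vertex A) + deg H (vertex z) ∸ 2   ≡⟨ cong₂ (λ x y → x + y ∸ 2) deg-A (trans deg-z (sym deg-B)) ⟩
          degree A + degree B ∸ 2                   ≡⟨ cong (_∸ 2) (sym XY≡AB) ⟩
          degree X + degree Y ∸ 2                   ≡⟨ sym (cong₂ (λ x y → x + y ∸ 2) (G-deg (u e)) (G-deg (v e))) ⟩
          deg G (u e) + deg G (v e) ∸ 2             ∎
          where
          open ≡-Reasoning
          XY≡AB : degree X + degree Y ≡ degree A + degree B
          XY≡AB = by-choice (λ a c → degree X + degree Y ≡ degree a + degree c) refl (+-comm (degree X) (degree Y))

        long : ℕ → ℕ
        long zero = A
        long (suc i) = z + i

        long-bound : ∀ i → i ≤ L → long i < N
        long-bound zero _ = A<N
        long-bound (suc i) l = <-≤-trans (+-monoʳ-< z l) z-block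

        long-injective : InjectiveUpTo L long
        long-injective zero zero _ _ _ = refl
        long-injective zero (suc j) _ l q = ⊥-elim (outside-block j A-outside l q)
        long-injective (suc i) zero l _ q = ⊥-elim (outside-block i A-outside l (sym q))
        long-injective (suc i) (suc j) _ _ q = cong suc (+-cancelˡ-≡ z i j q)

        long-links : ∀ i → i < L → moved (long i) (long (suc i)) ≡ true
        long-links zero _ rewrite +-identityʳ z = ∨-r {link A z ∧ not (isPair X Y A z)} (isPair-xy A z)
        long-links (suc j) l = ∨-l (and-not (isPair X Y (z + j) (z + suc j)) (Link⇒link (inj₁ (block-step z j z-start l)))
          (isPair-false {X} {Y} {z + j} {z + suc j} (λ { (p , _) → outside-block j X-outside (<⇒≤ l) (sym p) })
                                                    (λ { (p , _) → outside-block j Y-outside (<⇒≤ l) (sym p) })))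

        H≇G : ¬ Iso H G
        H≇G (σ , iso) = noLongPath _ (proj₁ image) (λ i i< → link⇒Link (proj₂ image i i<))
          where
          image = transport-path moved link σ (λ i j → trans (iso i j) (G-adj (Inverse.to σ i) (Inverse.to σ j)))
                                 L long long-bound long-injective long-links

        H-contains : (f : Fin 1 → Edge G) → f F.zero ≡ e → ContainedIn G 1 f H
        H-contains f refl = (λ _ → e′) , (λ { {F.zero} {F.zero} _ → refl }) ,
                            λ { F.zero → (↔-id _ , same-card) , same-edge-degree }

      Orientation : ℕ → ℕ → Set
      Orientation X Y =
        Σ ℕ λ A → Σ ℕ λ B → ((A ≡ X × B ≡ Y) ⊎ (A ≡ Y × B ≡ X)) × ¬ B % L ≡ 0 × ¬ suc B % L ≡ 0

      FreeBlock : ℕ → ℕ → Set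
      FreeBlock X Y = Σ ℕ λ z → z % L ≡ 0 × z + L ≤ N × OutsideBlock z X × OutsideBlock z Y

      no-single-determination : ∀ (f : Fin 1 → Edge G) → ¬ Determines G 1 f
      no-single-determination f det = refute orientation free-block
        where
        e = f F.zero
        X = toℕ (u e)
        Y = toℕ (v e)
        XY-step : Step X Y
        XY-step with link⇒Link (trans (sym (G-adj (u e) (v e))) (isEdge e))
        ... | inj₁ s = s
        ... | inj₂ (q , _) = ⊥-elim (<-irrefl refl (≤-trans (u<v e) (≤-trans (n≤1+n Y) (≤-reflexive (sym q)))))
        Y-not-start : ¬ Y % L ≡ 0
        Y-not-start q = proj₂ XY-step (trans (cong (_% L) (sym (proj₁ XY-step))) q)
        -- B = Y unless Y ends its block; then B = X, as blocks have L ≥ 3 vertices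
        orientation : Orientation X Y
        orientation with suc Y % L ≟ 0
        ... | no Y-not-end = X , Y , inj₁ (refl , refl) , Y-not-start , Y-not-end
        ... | yes Y-end = Y , X , inj₂ (refl , refl) , X-not-start , proj₂ XY-step
          where
          X-not-start : ¬ X % L ≡ 0
          X-not-start q = 1+n≢0 (trans (sym (offset-in-block 2 q 2<L))
                                (trans (cong (_% L) (trans (+-comm X 2) (cong suc (sym (proj₁ XY-step))))) Y-end))
        -- the second block if e lies in the first one, the first block otherwise
        free-block : FreeBlock X Y
        free-block with X <? L
        ... | yes X<L = L , L%L , 2L≤N , inj₁ X<L ,
                        inj₁ (below-L (subst (_≤ L) (sym (proj₁ XY-step)) X<L) Y-not-start)
        ... | no X≮L = 0 , 0%L , <⇒≤ L<N , inj₂ (≮⇒≥ X≮L) , inj₂ (≤-trans (≮⇒≥ X≮L) (<⇒≤ (u<v e)))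
        refute : Orientation X Y → FreeBlock X Y → ⊥
        refute (A , B , choice , B-not-start , B-not-end) (z , z-start , z-block , X-out , Y-out) =
          det M.H M.H-simple M.H≇G (M.H-contains f refl)
          where
          module M = MovedEdge e A B z XY-step choice B-not-start B-not-end z-start z-block X-out Y-out

      1<N : 1 < N
      1<N = <-trans 1<L L<N

      2<N : 2 < N
      2<N = <-trans 2<L L<N

      edge01 : Edge G
      edge01 = mkEdge (vertex 0) (vertex 1)
        (subst₂ _<_ (sym (vertex-value 0<N)) (sym (vertex-value 1<N)) (s≤s z≤n))
        (trans (G-adj (vertex 0) (vertex 1))
               (subst₂ (λ a b → link a b ≡ true) (sym (vertex-value 0<N)) (sym (vertex-value 1<N)) (Link⇒link (inj₁ Step01))))

      edge12 : Edge G
      edge12 = mkEdge (vertex 1) (vertex 2)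
        (subst₂ _<_ (sym (vertex-value 1<N)) (sym (vertex-value 2<N)) (s≤s (s≤s z≤n)))
        (trans (G-adj (vertex 1) (vertex 2))
               (subst₂ (λ a b → link a b ≡ true) (sym (vertex-value 1<N)) (sym (vertex-value 2<N)) (Link⇒link (inj₁ Step12))))

      cards : Fin 2 → Edge G
      cards F.zero = edge01
      cards (F.suc F.zero) = edge12

      cards-distinct : DistinctEdges G 2 cards
      cards-distinct {F.zero} {F.zero} _ = refl
      cards-distinct {F.suc F.zero} {F.suc F.zero} _ = refl
      cards-distinct {F.zero} {F.suc F.zero} q = ⊥-elim (0≢1+n (vertex-injective 0<N 1<N (cong proj₁ q)))
      cards-distinct {F.suc F.zero} {F.zero} q = ⊥-elim (0≢1+n (vertex-injective 0<N 1<N (cong proj₁ (sym q))))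

      card01-adj : ∀ i j → adj (deleteEdge G edge01) i j ≡ minus01 (toℕ i) (toℕ j)
      card01-adj i j rewrite deleteEdge-adj G edge01 i j | G-adj i j | vertex-value 0<N | vertex-value 1<N = refl

      card12-adj : ∀ i j → adj (deleteEdge G edge12) i j ≡ minus12 (toℕ i) (toℕ j)
      card12-adj i j rewrite deleteEdge-adj G edge12 i j | G-adj i j | vertex-value 1<N | vertex-value 2<N = refl

      degree-0 : degree 0 ≡ 1
      degree-0 = count-value (λ (j : Fin N) → link 0 (toℕ j)) 1 1<N (λ j → link-at-start 0%L (toℕ j))

      degree-1 : degree 1 ≡ 2
      degree-1 = count-values (λ (j : Fin N) → link 1 (toℕ j)) 2 0 (λ ()) 2<N 0<N
        (λ j → link-interior (nonmultiple (s≤s z≤n) 1<L) (nonmultiple (s≤s z≤n) 2<L) (toℕ j))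

      edge01-degree : edeg G edge01 ≡ 1
      edge01-degree rewrite G-deg (vertex 0) | G-deg (vertex 1) | vertex-value 0<N | vertex-value 1<N
                          | degree-0 | degree-1 = refl

      reflect-below-N : ∀ a → a < N → reflect a < N
      reflect-below-N a l with a <? L
      ... | yes a<L = <-trans (reflect-small a a<L) L<N
      ... | no a≮L rewrite reflect-outside a (≮⇒≥ a≮L) = l

      reflectF : Fin N → Fin N
      reflectF i = vertex (reflect (toℕ i))

      reflectF-value : ∀ i → toℕ (reflectF i) ≡ reflect (toℕ i)
      reflectF-value i = vertex-value (reflect-below-N (toℕ i) (toℕ<n i))

      reflectF-involutive : ∀ i → reflectF (reflectF i) ≡ i
      reflectF-involutive i = toℕ-injective
        (trans (reflectF-value (reflectF i)) (trans (cong reflect (reflectF-value i)) (reflect-involutive (toℕ i))))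

      reflection : Fin N ↔ Fin N
      reflection = mk↔ₛ′ reflectF reflectF reflectF-involutive reflectF-involutive

      degree01 : ℕ → ℕ
      degree01 c = count (λ (j : Fin N) → minus01 c (toℕ j))

      degree01≥1 : ∀ c → c < N → ¬ c ≡ 0 → 1 ≤ degree01 c
      degree01≥1 c l nz with minus01-neighbour c nz
      ... | b , cb , b-bound = count≥1 (vertex b) (subst (λ x → minus01 c x ≡ true) (sym (vertex-value (b<N b-bound))) cb)
        where
        b<N : (b < c ⊎ (b ≡ suc c × ¬ suc c % L ≡ 0)) → b < N
        b<N (inj₁ b<c) = <-trans b<c l
        b<N (inj₂ (q , ne)) = subst (_< N) (sym q) (step-below-N c l ne)

      degree01≥2 : ∀ c → c < N → ¬ c ≡ 0 → ¬ c ≡ 1 → ¬ c % L ≡ 0 → ¬ suc c % L ≡ 0 → 2 ≤ degree01 c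
      degree01≥2 c l n0 n1 m₁ m₂ = count-values≥2 (λ (j : Fin N) → minus01 c (toℕ j)) (pred c) (suc c) ne c-1<N c+1<N
          (subst (λ x → minus01 c x ≡ true) (sym (vertex-value c-1<N)) (proj₁ (minus01-both-neighbours c n0 n1 m₁ m₂)))
          (subst (λ x → minus01 c x ≡ true) (sym (vertex-value c+1<N)) (proj₂ (minus01-both-neighbours c n0 n1 m₁ m₂)))
        where
        c-1<N = ≤-<-trans pred[n]≤n l
        c+1<N = step-below-N c l m₂
        ne : ¬ pred c ≡ suc c
        ne q = <-irrefl q (≤-<-trans pred[n]≤n (n<1+n c))

      -- an end of a path of G - {0,1} other than 0: the vertex 1, a block start or a block end
      PathEnd : ℕ → Set
      PathEnd w = w ≡ 1 ⊎ (w % L ≡ 0 ⊎ suc w % L ≡ 0)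

      low-degree-end : ∀ w → w < N → ¬ w ≡ 0 → degree01 w ≤ 1 → PathEnd w
      low-degree-end w l nz d with w ≟ 1 | w % L ≟ 0 | suc w % L ≟ 0
      ... | yes p | _ | _ = inj₁ p
      ... | no _ | yes p | _ = inj₂ (inj₁ p)
      ... | no _ | no _ | yes p = inj₂ (inj₂ p)
      ... | no n1 | no m₁ | no m₂ = ⊥-elim (<-irrefl refl (≤-trans (degree01≥2 w l nz n1 m₁ m₂) d))

      -- A block through w: the block starting at z, traversed from w to its
      -- other end as z + order 0 = w, z + order 1, …, z + order (L-1).
      record BlockThrough (w : ℕ) : Set where
        field
          z : ℕ
          order : ℕ → ℕ
          z-start : z % L ≡ 0
          L≤z : L ≤ z
          z-block : z + L ≤ N
          order<L : ∀ i → i < L → order i < L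
          order-injective : ∀ i j → i < L → j < L → order i ≡ order j → i ≡ j
          order-step : ∀ j → suc j < L → (order (suc j) ≡ suc (order j)) ⊎ (order j ≡ suc (order (suc j)))
          starts-at-w : z + order 0 ≡ w

      start≥L : ∀ {x} → x % L ≡ 0 → ¬ x ≡ 0 → L ≤ x
      start≥L {x} e nz with x <? L
      ... | yes x<L = ⊥-elim (nz (trans (sym (mod-small x<L)) e))
      ... | no x≮L = ≮⇒≥ x≮L

      block-below-N : ∀ {x} → x % L ≡ 0 → x < N → ∀ i → i < L → x + i < N
      block-below-N {x} _ l zero _ = subst (_< N) (sym (+-identityʳ x)) l
      block-below-N {x} e l (suc i) si<L = subst (_< N) (sym (+-suc x i))
        (step-below-N (x + i) (block-below-N e l i (<⇒≤ si<L)) (proj₂ (block-step x i e si<L)))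

      L-1<L : L ∸ 1 < L
      L-1<L = ∸-monoʳ-< {L} {1} {0} (s≤s z≤n) (<⇒≤ 1<L)

      block-from-start : ∀ w → w < N → ¬ w ≡ 0 → w % L ≡ 0 → BlockThrough w
      block-from-start w l nz e = record
        { z = w ; order = λ i → i ; z-start = e ; L≤z = start≥L e nz
        ; z-block = subst (_≤ N) (trans (sym (+-suc w (L ∸ 1))) (cong (w +_) (∸-suc {L} {0} (<⇒≤ 1<L))))
                          (block-below-N e l (L ∸ 1) L-1<L)
        ; order<L = λ _ l → l ; order-injective = λ _ _ _ _ e → e ; order-step = λ _ _ → inj₁ refl
        ; starts-at-w = +-identityʳ w }

      block-from-end : ∀ w → w < N → L ≤ w → suc w % L ≡ 0 → BlockThrough w
      block-from-end w l L≤w e = record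
        { z = z ; order = λ i → L ∸ 1 ∸ i ; z-start = z-start ; L≤z = start≥L z-start z≢0
        ; z-block = subst (_≤ N) (sym (m∸n+n≡m L≤w+1)) l
        ; order<L = λ i _ → ≤-<-trans (m∸n≤m (L ∸ 1) i) L-1<L
        ; order-injective = λ i j il jl e → ∸-cancelˡ-≡ (∸-monoˡ-≤ 1 il) (∸-monoˡ-≤ 1 jl) e
        ; order-step = λ j sj → inj₂ (sym (∸-suc {L ∸ 1} {j} (∸-monoˡ-≤ 1 sj)))
        ; starts-at-w = starts }
        where
        z = suc w ∸ L
        L≤w+1 : L ≤ suc w
        L≤w+1 = ≤-trans L≤w (n≤1+n w)
        z-start : z % L ≡ 0
        z-start = trans (m≤n⇒[n∸m]%m≡n%m L≤w+1) e
        z≢0 : ¬ z ≡ 0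
        z≢0 q = <-irrefl refl (≤-trans (s≤s L≤w) (m∸n≡0⇒m≤n q))
        starts : z + (L ∸ 1) ≡ w
        starts = begin
          z + (L ∸ 1)   ≡⟨ sym (+-∸-assoc z {L} {1} (<⇒≤ 1<L)) ⟩
          z + L ∸ 1     ≡⟨ cong (_∸ 1) (m∸n+n≡m L≤w+1) ⟩
          w             ∎
          where open ≡-Reasoning

      unique-neighbour-transport : (Fa Gb : ℕ → ℕ → Bool) (ρ : Fin N ↔ Fin N) →
        (∀ i j → Fa (toℕ i) (toℕ j) ≡ Gb (toℕ (Inverse.to ρ i)) (toℕ (Inverse.to ρ j))) →
        ∀ x y → x < N → y < N → (∀ c → Fa x c ≡ true → c ≡ y) →
        ∀ w → w < N → Gb (toℕ (Inverse.to ρ (vertex x))) w ≡ true → w ≡ toℕ (Inverse.to ρ (vertex y))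
      unique-neighbour-transport Fa Gb ρ iso x y x<N y<N unique w w<N e =
        trans (sym ρc-value) (cong (λ v → toℕ (Inverse.to ρ v)) c≡y)
        where
        c = Inverse.from ρ (vertex w)
        ρc-value : toℕ (Inverse.to ρ c) ≡ w
        ρc-value = trans (cong toℕ (Inverse.inverseˡ ρ refl)) (vertex-value w<N)
        x~c : Fa x (toℕ c) ≡ true
        x~c = subst (λ v → Fa v (toℕ c) ≡ true) (vertex-value x<N)
                (trans (iso (vertex x) c) (subst (λ v → Gb (toℕ (Inverse.to ρ (vertex x))) v ≡ true) (sym ρc-value) e))
        c≡y : c ≡ vertex y
        c≡y = toℕ-injective (trans (unique (toℕ c) x~c) (sym (vertex-value y<N)))

      -- If L ≤ w, no graph G - {0,1} + {0,w} - {s,t} is isomorphic to G - {1,2}: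
      -- either {s,t} misses the path 0, w, … through the block of w, which has
      -- L+1 vertices, or it keeps the component 1 … L-1 intact.
      module FarReattachment (w s t : ℕ) (L≤w : L ≤ w) (blk : BlockThrough w) (ρ : Fin N ↔ Fin N)
          (iso : ∀ i j → reattach-minus w s t (toℕ i) (toℕ j) ≡
                         minus12 (toℕ (Inverse.to ρ i)) (toℕ (Inverse.to ρ j))) where
        open BlockThrough blk
        open IsolatedPath k using (K; L≡K+2; 1<K; LinkNot12; noIsolatedPath)

        ρv : ℕ → ℕ
        ρv x = toℕ (Inverse.to ρ (vertex x))

        OnLongPath : ℕ → Set
        OnLongPath x = x ≡ 0 ⊎ (z ≤ x × x < z + L)

        on-long-path? : ∀ x → Dec (OnLongPath x)
        on-long-path? x with x ≟ 0 | z ≤? x | x <? z + L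
        ... | yes p | _ | _ = yes (inj₁ p)
        ... | no _ | yes a | yes b = yes (inj₂ (a , b))
        ... | no p | no a | _ = no λ { (inj₁ q) → p q ; (inj₂ (q , _)) → a q }
        ... | no p | yes _ | no b = no λ { (inj₁ q) → p q ; (inj₂ (_ , q)) → b q }

        long : ℕ → ℕ
        long zero = 0
        long (suc i) = z + order i

        long-on : ∀ i → i ≤ L → OnLongPath (long i)
        long-on zero _ = inj₁ refl
        long-on (suc i) l = inj₂ (m≤m+n z (order i) , +-monoʳ-< z (order<L i l))

        long-bound : ∀ i → i ≤ L → long i < N
        long-bound zero _ = 0<N
        long-bound (suc i) l = <-≤-trans (+-monoʳ-< z (order<L i l)) z-block

        long-injective : InjectiveUpTo L long
        long-injective zero zero _ _ _ = refl
        long-injective zero (suc j) _ _ q = ⊥-elim (in-block≢0 (order j) q)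
          where
          in-block≢0 : ∀ x → ¬ 0 ≡ z + x
          in-block≢0 x q = <-irrefl refl (≤-trans (≤-trans (<⇒≤ 1<L) L≤z) (≤-trans (m≤m+n z x) (≤-reflexive (sym q))))
        long-injective (suc i) zero il jl q = sym (long-injective zero (suc i) jl il (sym q))
        long-injective (suc i) (suc j) il jl q = cong suc (order-injective i j il jl (+-cancelˡ-≡ z (order i) (order j) q))

        long-in-block : ∀ j → suc j < L → minus01 (z + order j) (z + order (suc j)) ≡ true
        long-in-block j l with order-step j l
        ... | inj₁ e rewrite e = minus01-block-step z (order j) z-start L≤z (subst (_< L) e (order<L (suc j) l))
        ... | inj₂ e rewrite e = trans (minus01-sym (z + suc (order (suc j))) (z + order (suc j)))
                 (minus01-block-step z (order (suc j)) z-start L≤z (subst (_< L) e (order<L j (<⇒≤ l))))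

        keeps-long-path : ¬ (OnLongPath s × OnLongPath t) → ⊥
        keeps-long-path missed = noLongPath _ (proj₁ image) (λ i i< → link⇒Link (∧-l (proj₂ image i i<)))
          where
          not-deleted : ∀ {a b} → OnLongPath a → OnLongPath b → isPair s t a b ≡ false
          not-deleted {a} {b} pa pb = isPair-false {s} {t} {a} {b}
            (λ { (p , q) → missed (subst OnLongPath p pa , subst OnLongPath q pb) })
            (λ { (p , q) → missed (subst OnLongPath q pb , subst OnLongPath p pa) })
          long-links : ∀ i → i < L → reattach-minus w s t (long i) (long (suc i)) ≡ true
          long-links zero l = and-not (isPair s t 0 (z + order 0))
             (∨-r {minus01 0 (z + order 0)} (subst (λ x → isPair 0 w 0 x ≡ true) (sym starts-at-w) (isPair-xy 0 w)))
             (not-deleted (long-on 0 z≤n) (long-on 1 l))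
          long-links (suc j) l = and-not (isPair s t (z + order j) (z + order (suc j)))
             (∨-l (long-in-block j l)) (not-deleted (long-on (suc j) (<⇒≤ l)) (long-on (suc (suc j)) l))
          image = transport-path (reattach-minus w s t) minus12 ρ iso L long long-bound long-injective long-links

        short : ℕ → ℕ
        short i = suc i

        short-bound : ∀ i → i ≤ K → short i < N
        short-bound i l = <-trans (subst (suc i <_) (sym L≡K+2) (s≤s (s≤s l))) L<N

        short-image : ℕ → ℕ
        short-image i = ρv (short i)

        short-image-bound : ∀ i → i ≤ K → short-image i < k * L
        short-image-bound i _ = subst (short-image i <_) (kP-size k) (toℕ<n (Inverse.to ρ (vertex (short i))))

        minus12⇒LinkNot12 : ∀ {x y} → minus12 x y ≡ true → LinkNot12 x y
        minus12⇒LinkNot12 {x} {y} e = link⇒Link (∧-l e) , isPair-false⁻ {1} {2} {x} {y} (not-true (∧-r {link x y} e))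

        LinkNot12⇒minus12 : ∀ {x y} → LinkNot12 x y → minus12 x y ≡ true
        LinkNot12⇒minus12 {x} {y} (l , n₁ , n₂) = and-not (isPair 1 2 x y) (Link⇒link l) (isPair-false {1} {2} {x} {y} n₁ n₂)

        -- the ends of the image have no neighbours off the image, as 1 and L-1 have none (L ≤ w)
        image-end-1 : ∀ x → x < k * L → LinkNot12 (short-image 0) x → x ≡ short-image 1
        image-end-1 x l adj = unique-neighbour-transport (reattach-minus w s t) minus12 ρ iso 1 2 1<N 2<N
          (λ c → reattach-minus-end1 w s t c L≤w) x (subst (x <_) (sym (kP-size k)) l) (LinkNot12⇒minus12 adj)

        image-end-L-1 : ∀ x → x < k * L → LinkNot12 (short-image K) x → x ≡ short-image (K ∸ 1)
        image-end-L-1 x l adj = unique-neighbour-transport (reattach-minus w s t) minus12 ρ iso (suc K) (suc (K ∸ 1))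
          (short-bound K ≤-refl) (short-bound (K ∸ 1) (m∸n≤m K 1))
          (λ c e → trans (reattach-minus-endL w s t c L≤w (subst (λ v → reattach-minus w s t v c ≡ true) (∸-suc 1<L) e))
                         (sym (∸-suc {K} {0} (≤-trans (s≤s z≤n) 1<K))))
          x (subst (x <_) (sym (kP-size k)) l) (LinkNot12⇒minus12 adj)

        keeps-short-path : OnLongPath s → OnLongPath t → ⊥
        keeps-short-path on-s on-t = noIsolatedPath short-image (proj₁ image) short-image-bound
            (λ i l → minus12⇒LinkNot12 (proj₂ image i l)) (image-end-1 , image-end-L-1)
          where
          outside : ∀ {x} → OnLongPath x → Outside1toL x
          outside (inj₁ p) = inj₁ p
          outside (inj₂ (p , _)) = inj₂ (≤-trans L≤z p)
          short-links : ∀ i → i < K → reattach-minus w s t (short i) (short (suc i)) ≡ true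
          short-links i l = reattach-minus-step w s t (suc i) (outside on-s) (outside on-t) (s≤s z≤n)
                              (subst (suc (suc i) <_) (sym L≡K+2) (s≤s (s≤s l)))
          image = transport-path (reattach-minus w s t) minus12 ρ iso K short short-bound (λ _ _ _ _ → suc-injective) short-links

        impossible : ⊥
        impossible with on-long-path? s | on-long-path? t
        ... | yes on-s | yes on-t = keeps-short-path on-s on-t
        ... | no off-s | _ = keeps-long-path (λ { (on-s , _) → off-s on-s })
        ... | yes _ | no off-t = keeps-long-path (λ { (_ , on-t) → off-t on-t })

      module Reconstruction (H : Graph) (H-simple : IsSimple H) (g : Fin 2 → Edge H)
          (same : ∀ i → Iso (deleteEdge H (g i)) (deleteEdge G (cards i)) × (edeg H (g i) ≡ edeg G (cards i))) where

        e₁ e₂ : Edge H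
        e₁ = g F.zero
        e₂ = g (F.suc F.zero)

        σ τ : Fin (n H) ↔ Fin N
        σ = proj₁ (proj₁ (same F.zero))
        τ = proj₁ (proj₁ (same (F.suc F.zero)))

        σv : Fin (n H) → ℕ
        σv p = toℕ (Inverse.to σ p)

        X Y : ℕ
        X = σv (u e₁)
        Y = σv (v e₁)

        H-adj : ∀ p q → adj H p q ≡ minus01 (σv p) (σv q) ∨ isPair X Y (σv p) (σv q)
        H-adj p q = trans (restore-edge H H-simple e₁ p q)
          (cong₂ _∨_ (trans (proj₂ (proj₁ (same F.zero)) p q) (card01-adj (Inverse.to σ p) (Inverse.to σ q)))
                     (isPair-injective (Inverse.to σ) (to-injective σ) (u e₁) (v e₁) p q))

        card-deg : ∀ p → deg (deleteEdge H e₁) p ≡ degree01 (σv p)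
        card-deg p = trans (iso-deg (deleteEdge H e₁) (deleteEdge G edge01) (proj₁ (same F.zero)) p)
                           (trans (deg≡count (deleteEdge G edge01) (Inverse.to σ p)) (count-cong (card01-adj (Inverse.to σ p))))

        -- d(e₁) = 1: X and Y together have at most one edge in G - {0,1}
        XY-degrees : degree01 X + degree01 Y ≤ 1
        XY-degrees = s≤s⁻¹ (s≤s⁻¹ (subst (_≤ 3) rearrange (subst (degree01 X + 1 + (degree01 Y + 1) ≤_) deg-sum
          (+-mono-≤ (subst (λ d → d + 1 ≤ deg H (u e₁)) (card-deg (u e₁))
                             (deleteEdge-deg H e₁ (u e₁) (v e₁) (isEdge e₁) (isPair-xy (toℕ (u e₁)) (toℕ (v e₁)))))
                    (subst (λ d → d + 1 ≤ deg H (v e₁)) (card-deg (v e₁))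
                             (deleteEdge-deg H e₁ (v e₁) (u e₁) (trans (proj₁ H-simple (v e₁) (u e₁)) (isEdge e₁))
                                             (isPair-yx (toℕ (u e₁)) (toℕ (v e₁)))))))))
          where
          monus-two : ∀ a → a ∸ 2 ≡ 1 → a ≡ 3
          monus-two (suc (suc (suc zero))) _ = refl
          monus-two (suc (suc (suc (suc _)))) ()
          deg-sum : deg H (u e₁) + deg H (v e₁) ≡ 3
          deg-sum = monus-two _ (trans (proj₂ (same F.zero)) edge01-degree)
          rearrange : degree01 X + 1 + (degree01 Y + 1) ≡ suc (suc (degree01 X + degree01 Y))
          rearrange = trans (cong₂ _+_ (+-comm (degree01 X) 1) (+-comm (degree01 Y) 1))
                            (cong suc (+-suc (degree01 X) (degree01 Y)))

        -- hence {X, Y} = {0, w} for an end w of a path of G - {0,1}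
        Reattachment : Set
        Reattachment = Σ ℕ λ w → w < N × ¬ w ≡ 0 × PathEnd w × (∀ a b → isPair X Y a b ≡ isPair 0 w a b)

        reattachment : Reattachment
        reattachment with X ≟ 0 | Y ≟ 0
        ... | yes X≡0 | _ = Y , toℕ<n _ , (λ Y≡0 → X≢Y (trans X≡0 (sym Y≡0))) ,
                            low-degree-end Y (toℕ<n _) (λ Y≡0 → X≢Y (trans X≡0 (sym Y≡0)))
                                           (≤-trans (m≤n+m (degree01 Y) (degree01 X)) XY-degrees) ,
                            (λ a b → cong (λ x → isPair x Y a b) X≡0)
          where
          X≢Y : ¬ X ≡ Y
          X≢Y q = <-irrefl (cong toℕ (to-injective σ (toℕ-injective q))) (u<v e₁)
        ... | no X≢0 | yes Y≡0 = X , toℕ<n _ , X≢0 ,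
                                 low-degree-end X (toℕ<n _) X≢0 (≤-trans (m≤m+n (degree01 X) (degree01 Y)) XY-degrees) ,
                                 (λ a b → trans (cong (λ y → isPair X y a b) Y≡0) (isPair-swap X 0 a b))
        ... | no X≢0 | no Y≢0 = ⊥-elim (<-irrefl refl
                (≤-trans (+-mono-≤ (degree01≥1 X (toℕ<n _) X≢0) (degree01≥1 Y (toℕ<n _) Y≢0)) XY-degrees))

        far : ∀ w → L ≤ w → BlockThrough w → (∀ p q → adj H p q ≡ reattach w (σv p) (σv q)) → ⊥
        far w L≤w blk H≅ = FarReattachment.impossible w s t L≤w blk ρ second-card
          where
          s t : ℕ
          s = σv (u e₂)
          t = σv (v e₂)
          ρ : Fin N ↔ Fin N
          ρ = τ ↔-∘ ↔-sym σ
          second-card : ∀ i j → reattach-minus w s t (toℕ i) (toℕ j) ≡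
                                minus12 (toℕ (Inverse.to ρ i)) (toℕ (Inverse.to ρ j))
          second-card i j = begin
            reattach-minus w s t (toℕ i) (toℕ j)
              ≡⟨ cong₂ (λ x y → reattach-minus w s t (toℕ x) (toℕ y))
                       (sym (Inverse.inverseˡ σ refl)) (sym (Inverse.inverseˡ σ refl)) ⟩
            reattach w (σv p) (σv q) ∧ not (isPair s t (σv p) (σv q))
              ≡⟨ cong₂ (λ x y → x ∧ not y) (sym (H≅ p q))
                       (sym (isPair-injective (Inverse.to σ) (to-injective σ) (u e₂) (v e₂) p q)) ⟩
            adj H p q ∧ not (isPair (toℕ (u e₂)) (toℕ (v e₂)) (toℕ p) (toℕ q))
              ≡⟨ sym (deleteEdge-adj H e₂ p q) ⟩
            adj (deleteEdge H e₂) p q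
              ≡⟨ proj₂ (proj₁ (same (F.suc F.zero))) p q ⟩
            adj (deleteEdge G edge12) (Inverse.to τ p) (Inverse.to τ q)
              ≡⟨ card12-adj _ _ ⟩
            minus12 (toℕ (Inverse.to ρ i)) (toℕ (Inverse.to ρ j)) ∎
            where
            open ≡-Reasoning
            p = Inverse.from σ i
            q = Inverse.from σ j

        H≅G : ¬ ¬ Iso H G
        H≅G not-iso with reattachment
        ... | w , w<N , w≢0 , end , XY≡0w = by-end end
          where
          H≅ : ∀ p q → adj H p q ≡ reattach w (σv p) (σv q)
          H≅ p q = trans (H-adj p q) (cong (minus01 (σv p) (σv q) ∨_) (XY≡0w (σv p) (σv q)))
          by-end : PathEnd w → ⊥
          by-end (inj₁ refl) = not-iso (σ , λ p q → trans (H≅ p q)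
            (trans (reattach-1 (σv p) (σv q)) (sym (G-adj (Inverse.to σ p) (Inverse.to σ q)))))
          by-end (inj₂ block-end) with w <? L
          ... | no w≮L =
            far w (≮⇒≥ w≮L) ([ block-from-start w w<N w≢0 , block-from-end w w<N (≮⇒≥ w≮L) ] block-end) H≅
          ... | yes w<L with block-end
          ...   | inj₁ w-start = w≢0 (trans (sym (mod-small w<L)) w-start)
          -- w = L-1: H is G up to the reflection of the first block
          ...   | inj₂ w-end = not-iso (reflection ↔-∘ σ , λ p q → trans (H≅ p q)
                  (trans (cong (λ x → reattach x (σv p) (σv q)) w≡L-1)
                  (trans (reattach-last≡reflected (σv p) (σv q))
                         (sym (trans (G-adj (reflectF (Inverse.to σ p)) (reflectF (Inverse.to σ q)))
                                     (cong₂ link (reflectF-value (Inverse.to σ p)) (reflectF-value (Inverse.to σ q))))))))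
            where
            w≡L-1 : w ≡ L ∸ 1
            w≡L-1 with m≤n⇒m<n∨m≡n w<L
            ... | inj₁ w+1<L = ⊥-elim (nonmultiple (s≤s z≤n) w+1<L w-end)
            ... | inj₂ w+1≡L = cong (_∸ 1) w+1≡L

      cards-determine : Determines G 2 cards
      cards-determine H H-simple not-iso (g , _ , same) = Reconstruction.H≅G H H-simple g same not-iso

      dern≡2 : DernIs G 2
      dern≡2 = (cards , cards-distinct , cards-determine) , fewer
        where
        fewer : ∀ j → j < 2 → ∀ (f : Fin j → Edge G) → DistinctEdges G j f → ¬ Determines G j f
        fewer zero _ f _ = no-empty-determination f
        fewer (suc zero) _ f _ = no-single-determination f
        fewer (suc (suc _)) (s≤s (s≤s ())) _ _


mainTheorem5 : ∀ (n k : ℕ) → 3 < n → 1 < k → DernIs (copies k (path n)) 2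
mainTheorem5 n@(suc _) (suc (suc k')) 3<n _ = KPaths.Blocks.TheGraph.dern≡2 n 3<n k'
mainTheorem5 zero _ () _
mainTheorem5 (suc _) (suc zero) _ (s≤s ())
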